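{- Let $q=2^{2k+1}$, $F=\mathbb{F}_q$, $\sigma:\alpha\mapsto\alpha^{2^{k+1}}$, and $V=F\oplus F$. For $c=(\alpha,\beta)\in V$ let $$M_c=\begin{pmatrix}\alpha & \alpha^{\sigma^{ -1}}+\beta^{1+\sigma^{ -1}}\\ \alpha^{\sigma^{ -1}}+\beta^{1+\sigma^{ -1}} & \beta\end{pmatrix}.$$ Then the bases $$B_\infty=\{e_w\mid w\in V\},\qquad B_c=\{b_{c,v}\mid v\in V\}\ (c\in V),\qquad b_{c,v}=\frac1q\sum_{w\in V}\omega^{{\rm Tr}(\hat w\cdot\hat w\widehat{M_c}+2\hat v\cdot\hat w)}e_w,$$ form a complete set of mutually unbiased bases of $\mathbb{C}^{q^2}$.
   Context: $\omega\in\mathbb{C}$ is a primitive $4$th root of unity and $\{e_w\}_{w\in V}$ is the standard basis of $\mathbb{C}^{q^2}$ indexed by $V$. $\beta^{1+\sigma^{ -1}}=\beta\cdot\beta^{\sigma^{ -1}}$. $R=GR(4^{2k+1})$ is the Galois ring of characteristic $4$ and order $4^{2k+1}$ ($R/2R\cong F$), $\mathcal{T}=\{0\}\cup C$ its Teichmüller set ($C$ the cyclic subgroup of order $q-1$ of $R^*$), and $\hat u\in\mathcal{T}$ the Teichmüller lift of $u\in F$. For $w=(w_1,w_2)\in V$, $\hat w=(\hat w_1,\hat w_2)\in R^2$, and $\widehat{M_c}$ is the matrix obtained by lifting each entry of $M_c$. Vectors are row vectors, $\hat w\widehat{M_c}$ is the row-vector–matrix product and $\cdot$ is the standard dot product on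 $R^2$. For $x=a+2b$ ($a,b\in\mathcal{T}$), ${\rm Tr}(x)=\sum_{i=0}^{2k}(a^{2^i}+2b^{2^i})\in\mathbb{Z}_4$. A complete set of MUBs of $\mathbb{C}^{N}$ is a set of $N+1$ orthonormal bases with $|(x,y)|^2=1/N$ for $x,y$ in distinct bases. -}

module Defs where

open import Level using (0ℓ)
open import Data.Nat as ℕ using (ℕ; zero; suc; NonZero; _∸_)
import Data.Nat.Properties as ℕP
open import Data.Integer as ℤ using (ℤ; +_)
open import Data.Rational as ℚ using (ℚ; 0ℚ; 1ℚ)
open import Data.Fin as Fin using (Fin; zero; suc; _≟_; remQuot)
open import Data.Product using (Σ; ∃; _×_; _,_; proj₁; proj₂)
open import Data.Sum using (_⊎_)
open import Relation.Nullary using (¬_; yes; no)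
open import Relation.Binary using (Decidable)
open import Relation.Binary.PropositionalEquality using (_≡_; _≢_)
open import Algebra.Bundles using (CommutativeRing)
open import Algebra.Morphism.Structures using (module RingMorphisms)

qOf : ℕ → ℕ
qOf k = 2 ℕ.^ (2 ℕ.* k ℕ.+ 1)

qOf-nonZero : ∀ k → NonZero (qOf k)
qOf-nonZero k = ℕP.m^n≢0 2 (2 ℕ.* k ℕ.+ 1)

qq-nonZero : ∀ k → NonZero (qOf k ℕ.* qOf k)
qq-nonZero k = ℕP.m*n≢0 (qOf k) (qOf k) {{qOf-nonZero k}} {{qOf-nonZero k}}

-- Gaussian rationals ℚ(i) ⊂ ℂ  (all vectors of the statement have entries here)

infix 5 _+i_
record ℚi : Set where
  constructor _+i_
  field re im : ℚ

open ℚi public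

0i 1i -1i : ℚi
0i = 0ℚ +i 0ℚ
1i = 1ℚ +i 0ℚ
-1i = (ℚ.- 1ℚ) +i 0ℚ

_⊕_ : ℚi → ℚi → ℚi
(a +i b) ⊕ (c +i d) = (a ℚ.+ c) +i (b ℚ.+ d)

_⊗_ : ℚi → ℚi → ℚi
(a +i b) ⊗ (c +i d) = (a ℚ.* c ℚ.- b ℚ.* d) +i (a ℚ.* d ℚ.+ b ℚ.* c)

conj : ℚi → ℚi
conj (a +i b) = a +i (ℚ.- b)

normSq : ℚi → ℚ
normSq (a +i b) = a ℚ.* a ℚ.+ b ℚ.* b

_^i_ : ℚi → ℕ → ℚi
z ^i zero = 1i
z ^i suc n = z ⊗ (z ^i n)

sumi : ∀ N → (Fin N → ℚi) → ℚi
sumi zero f = 0i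
sumi (suc N) f = f zero ⊕ sumi N (λ i → f (suc i))

inner : ∀ {N} → (Fin N → ℚi) → (Fin N → ℚi) → ℚi
inner {N} x y = sumi N (λ w → conj (x w) ⊗ y w)

-- an orthonormal basis of ℂ^N: N vectors that are pairwise orthonormal
-- (N orthonormal vectors in ℂ^N always form a basis)
IsOrthonormalBasis : ∀ N → (Fin N → Fin N → ℚi) → Set
IsOrthonormalBasis N B =
  (∀ v → inner (B v) (B v) ≡ 1i) × (∀ v v′ → v ≢ v′ → inner (B v) (B v′) ≡ 0i)

IsCompleteMUB : ∀ N → .{{NonZero N}} → (Fin (suc N) → Fin N → Fin N → ℚi) → Set
IsCompleteMUB N B =
  (∀ a → IsOrthonormalBasis N (B a)) ×
  (∀ a b → a ≢ b → ∀ x y → normSq (inner (B a x) (B b y)) ≡ (+ 1) ℚ./ N)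

module RingNotions (R : CommutativeRing 0ℓ 0ℓ) where
  open CommutativeRing R

  pow : Carrier → ℕ → Carrier
  pow x zero = 1#
  pow x (suc n) = x * pow x n

  two three : Carrier
  two = 1# + 1#
  three = two + 1#

  sumR : ℕ → (ℕ → Carrier) → Carrier
  sumR zero f = 0#
  sumR (suc n) f = sumR n f + f n

  IsField : Set
  IsField = ¬ (1# ≈ 0#) × (∀ x → ¬ (x ≈ 0#) → ∃ λ y → x * y ≈ 1#)

  HasChar4 : Set
  HasChar4 = (two + two ≈ 0#) × ¬ (two ≈ 0#)

  IsEnumeration : ∀ n → (Fin n → Carrier) → Set
  IsEnumeration n e = (∀ i j → e i ≈ e j → i ≡ j) × (∀ x → ∃ λ i → e i ≈ x)

  -- Teichmüller set T = {0} ∪ C, C = the (unique) cyclic subgroup of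
  -- order q-1 of R*, i.e. C = {x | x^(q-1) = 1}
  InTeich : ℕ → Carrier → Set
  InTeich q x = (x ≈ 0#) ⊎ (pow x (q ∸ 1) ≈ 1#)

module Construction
  (k : ℕ)
  (F : CommutativeRing 0ℓ 0ℓ)
  (enumF : Fin (qOf k) → CommutativeRing.Carrier F)
  (R : CommutativeRing 0ℓ 0ℓ)
  (_≈R?_ : Decidable (CommutativeRing._≈_ R))
  (hat : CommutativeRing.Carrier F → CommutativeRing.Carrier R)   -- Teichmüller lift
  (decomp : CommutativeRing.Carrier R →
            CommutativeRing.Carrier R × CommutativeRing.Carrier R)  -- x = a + 2b, a,b ∈ T
  (ω : ℚi)
  where

  q : ℕ
  q = qOf k

  module FF = CommutativeRing F
  module RR = CommutativeRing R
  module FN = RingNotions F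
  module RN = RingNotions R

  -- σ⁻¹ : α ↦ α^(2^k)   (inverse of σ : α ↦ α^(2^(k+1)) on F_q, q = 2^(2k+1))
  σinv : FF.Carrier → FF.Carrier
  σinv α = FN.pow α (2 ℕ.^ k)

  offDiag : FF.Carrier → FF.Carrier → FF.Carrier
  offDiag α β = σinv α FF.+ (β FF.* σinv β)

  Tr : RR.Carrier → RR.Carrier
  Tr x = RN.sumR (2 ℕ.* k ℕ.+ 1)
           (λ i → RN.pow (proj₁ (decomp x)) (2 ℕ.^ i)
                  RR.+ RN.two RR.* RN.pow (proj₂ (decomp x)) (2 ℕ.^ i))

  -- reading an element of ℤ₄ = {0,1,2,3} ⊂ R as an exponent
  toℤ₄ : RR.Carrier → Fin 4
  toℤ₄ x with x ≈R? RR.0#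
  ... | yes _ = Fin.zero
  ... | no _ with x ≈R? RR.1#
  ... | yes _ = Fin.suc Fin.zero
  ... | no _ with x ≈R? RN.two
  ... | yes _ = Fin.suc (Fin.suc Fin.zero)
  ... | no _ = Fin.suc (Fin.suc (Fin.suc Fin.zero))

  ωpow : Fin 4 → ℚi
  ωpow j = ω ^i Fin.toℕ j

  expo : FF.Carrier → FF.Carrier → FF.Carrier → FF.Carrier →
         FF.Carrier → FF.Carrier → RR.Carrier
  expo α β v1 v2 w1 w2 =
    let a = hat α ; m = hat (offDiag α β) ; b = hat β
        x1 = hat w1 ; x2 = hat w2 ; y1 = hat v1 ; y2 = hat v2
        r1 = x1 RR.* a RR.+ x2 RR.* m
        r2 = x1 RR.* m RR.+ x2 RR.* b
    in (x1 RR.* r1 RR.+ x2 RR.* r2) RR.+ RN.two RR.* (y1 RR.* x1 RR.+ y2 RR.* x2)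

  pt : Fin (q ℕ.* q) → FF.Carrier × FF.Carrier
  pt i = enumF (proj₁ (remQuot {q} q i)) , enumF (proj₂ (remQuot {q} q i))

  invQ : ℚ
  invQ = ((+ 1) ℚ./ q) {{qOf-nonZero k}}

  b : (c v w : Fin (q ℕ.* q)) → ℚi
  b c v w = (invQ +i 0ℚ) ⊗
            ωpow (toℤ₄ (Tr (expo (proj₁ (pt c)) (proj₂ (pt c))
                                 (proj₁ (pt v)) (proj₂ (pt v))
                                 (proj₁ (pt w)) (proj₂ (pt w)))))

  e : (v w : Fin (q ℕ.* q)) → ℚi
  e v w with v ≟ w
  ... | yes _ = 1i
  ... | no _ = 0i

  bases : Fin (suc (q ℕ.* q)) → Fin (q ℕ.* q) → Fin (q ℕ.* q) → ℚi
  bases zero = e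
  bases (suc c) = b c

module Submission where

-- Everything except the unbiasedness of two bases B_c, B_c′ (c ≠ c′) is routine, since all phases have
-- modulus one. With ψ = ω^Tr the canonical additive character of the Galois ring R, the phase of b_{c,v}
-- at w factors as χ(α w₁²) χ(β w₂²) ε(m w₁ w₂ + v·w), where ε(u) = ψ(2û) is an additive character of F and
-- χ(u) = ψ(û) satisfies χ(u + v) = χ(u) χ(v) ε(√(uv)). Translating w by y therefore multiplies the phase by
-- ε of the polar form z M_c yᵀ, so for the Gauss sum S = Σ_w conj(b_{c,v}(w)) b_{c′,v′}(w) (up to q⁻²)
-- the product conj(S) S collapses to Σ_y f(y) Σ_z ε(z (M_c + M_c′) yᵀ) with |f(y)| = 1 and f(0) = 1.
-- The inner sum vanishes unless y lies in the kernel of M_c + M_c′, which is trivial: for β = β′ this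
-- reduces to σ⁻¹ being injective, and otherwise a singular M_c + M_c′ would contradict the absolute
-- trace being 1 on 1 and invariant under σ⁻¹ and squaring. Hence |S|² = q² and |⟨b_{c,v}, b_{c′,v′}⟩|² = 1/q².

open import Defs
open import Level using (0ℓ)
open import Data.Nat as ℕ using (ℕ; zero; suc)
import Data.Nat.Properties as ℕP
open import Data.Integer as ℤ using (+_; -[1+_])
import Data.Integer.Properties as ℤP
open import Data.Rational as ℚ using (ℚ; 0ℚ; 1ℚ; mkℚ)
import Data.Rational.Properties as ℚP
import Data.Rational.Unnormalised as ℚᵘ
import Data.Rational.Unnormalised.Properties as ℚᵘP
open import Data.Fin as Fin using (Fin; zero; suc; toℕ)
import Data.Fin.Properties as FinP
import Data.Fin.Permutation as Perm
open import Data.Product using (Σ; ∃; _×_; _,_; proj₁; proj₂)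
open import Data.Sum using (_⊎_; inj₁; inj₂)
open import Data.Empty using (⊥-elim)
open import Relation.Nullary using (¬_; yes; no)
open import Relation.Binary using (Decidable)
import Relation.Binary.PropositionalEquality as P
open P using (_≡_; _≢_; cong; cong₂)
open import Algebra.Bundles using (CommutativeRing)
open import Algebra.Structures using (IsCommutativeRing)
open import Algebra.Morphism.Structures using (module RingMorphisms)
import Algebra.Properties.AbelianGroup as AbelianGroupProperties
import Relation.Binary.Reasoning.Setoid as SetoidReasoning
open import Data.Rational.Solver using (module +-*-Solver)

module GaussianRationals where

  open +-*-Solver
  open P using (refl; sym; trans)

  -ᵢ_ : ℚi → ℚi
  -ᵢ (a +i b) = (ℚ.- a) +i (ℚ.- b)

  ⊕-assoc : ∀ x y z → (x ⊕ y) ⊕ z ≡ x ⊕ (y ⊕ z)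
  ⊕-assoc (a +i b) (c +i d) (e +i f) = cong₂ _+i_ (ℚP.+-assoc a c e) (ℚP.+-assoc b d f)

  ⊕-comm : ∀ x y → x ⊕ y ≡ y ⊕ x
  ⊕-comm (a +i b) (c +i d) = cong₂ _+i_ (ℚP.+-comm a c) (ℚP.+-comm b d)

  ⊕-identityˡ : ∀ x → 0i ⊕ x ≡ x
  ⊕-identityˡ (a +i b) = cong₂ _+i_ (ℚP.+-identityˡ a) (ℚP.+-identityˡ b)

  ⊕-identityʳ : ∀ x → x ⊕ 0i ≡ x
  ⊕-identityʳ x = trans (⊕-comm x 0i) (⊕-identityˡ x)

  ⊕-inverseˡ : ∀ x → (-ᵢ x) ⊕ x ≡ 0i
  ⊕-inverseˡ (a +i b) = cong₂ _+i_ (ℚP.+-inverseˡ a) (ℚP.+-inverseˡ b)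

  ⊕-inverseʳ : ∀ x → x ⊕ (-ᵢ x) ≡ 0i
  ⊕-inverseʳ x = trans (⊕-comm x (-ᵢ x)) (⊕-inverseˡ x)

  ⊗-assoc : ∀ x y z → (x ⊗ y) ⊗ z ≡ x ⊗ (y ⊗ z)
  ⊗-assoc (a +i b) (c +i d) (e +i f) = cong₂ _+i_
    (solve 6 (λ a b c d e f → (a :* c :- b :* d) :* e :- (a :* d :+ b :* c) :* f
                            := a :* (c :* e :- d :* f) :- b :* (c :* f :+ d :* e)) refl a b c d e f)
    (solve 6 (λ a b c d e f → (a :* c :- b :* d) :* f :+ (a :* d :+ b :* c) :* e
                            := a :* (c :* f :+ d :* e) :+ b :* (c :* e :- d :* f)) refl a b c d e f)

  ⊗-comm : ∀ x y → x ⊗ y ≡ y ⊗ x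
  ⊗-comm (a +i b) (c +i d) = cong₂ _+i_
    (solve 4 (λ a b c d → a :* c :- b :* d := c :* a :- d :* b) refl a b c d)
    (solve 4 (λ a b c d → a :* d :+ b :* c := c :* b :+ d :* a) refl a b c d)

  ⊗-identityˡ : ∀ x → 1i ⊗ x ≡ x
  ⊗-identityˡ (a +i b) = cong₂ _+i_
    (solve 2 (λ a b → con 1ℚ :* a :- con 0ℚ :* b := a) refl a b)
    (solve 2 (λ a b → con 1ℚ :* b :+ con 0ℚ :* a := b) refl a b)

  ⊗-identityʳ : ∀ x → x ⊗ 1i ≡ x
  ⊗-identityʳ x = trans (⊗-comm x 1i) (⊗-identityˡ x)

  ⊗-distribˡ-⊕ : ∀ x y z → x ⊗ (y ⊕ z) ≡ (x ⊗ y) ⊕ (x ⊗ z)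
  ⊗-distribˡ-⊕ (a +i b) (c +i d) (e +i f) = cong₂ _+i_
    (solve 6 (λ a b c d e f → a :* (c :+ e) :- b :* (d :+ f) := (a :* c :- b :* d) :+ (a :* e :- b :* f)) refl a b c d e f)
    (solve 6 (λ a b c d e f → a :* (d :+ f) :+ b :* (c :+ e) := (a :* d :+ b :* c) :+ (a :* f :+ b :* e)) refl a b c d e f)

  ⊗-distribʳ-⊕ : ∀ x y z → (y ⊕ z) ⊗ x ≡ (y ⊗ x) ⊕ (z ⊗ x)
  ⊗-distribʳ-⊕ x y z = trans (⊗-comm (y ⊕ z) x)
    (trans (⊗-distribˡ-⊕ x y z) (cong₂ _⊕_ (⊗-comm x y) (⊗-comm x z)))

  ℚi-isCommutativeRing : IsCommutativeRing _≡_ _⊕_ _⊗_ -ᵢ_ 0i 1i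
  ℚi-isCommutativeRing = record
    { isRing = record
      { +-isAbelianGroup = record
        { isGroup = record
          { isMonoid = record
            { isSemigroup = record
              { isMagma = record { isEquivalence = P.isEquivalence ; ∙-cong = cong₂ _⊕_ }
              ; assoc = ⊕-assoc }
            ; identity = ⊕-identityˡ , ⊕-identityʳ }
          ; inverse = ⊕-inverseˡ , ⊕-inverseʳ
          ; ⁻¹-cong = cong -ᵢ_ }
        ; comm = ⊕-comm }
      ; *-cong = cong₂ _⊗_
      ; *-assoc = ⊗-assoc
      ; *-identity = ⊗-identityˡ , ⊗-identityʳ
      ; distrib = ⊗-distribˡ-⊕ , ⊗-distribʳ-⊕ }
    ; *-comm = ⊗-comm }

  ℚi-commutativeRing : CommutativeRing 0ℓ 0ℓ
  ℚi-commutativeRing = record { isCommutativeRing = ℚi-isCommutativeRing }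

  open CommutativeRing ℚi-commutativeRing public
    using () renaming (zeroˡ to ⊗-zeroˡ; zeroʳ to ⊗-zeroʳ)
  open import Algebra.Properties.Semiring.Sum (CommutativeRing.semiring ℚi-commutativeRing) public

  conj-⊗ : ∀ x y → conj (x ⊗ y) ≡ conj x ⊗ conj y
  conj-⊗ (a +i b) (c +i d) = cong₂ _+i_
    (solve 4 (λ a b c d → a :* c :- b :* d := a :* c :- (:- b) :* (:- d)) refl a b c d)
    (solve 4 (λ a b c d → :- (a :* d :+ b :* c) := a :* (:- d) :+ (:- b) :* c) refl a b c d)

  conj-⊕ : ∀ x y → conj (x ⊕ y) ≡ conj x ⊕ conj y
  conj-⊕ (a +i b) (c +i d) = cong (_ +i_) (ℚP.neg-distrib-+ b d)

  conj-involutive : ∀ x → conj (conj x) ≡ x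
  conj-involutive (a +i b) = cong (a +i_) (solve 1 (λ b → :- (:- b) := b) refl b)

  normSq-⊗ : ∀ x y → normSq (x ⊗ y) ≡ normSq x ℚ.* normSq y
  normSq-⊗ (a +i b) (c +i d) =
    solve 4 (λ a b c d → (a :* c :- b :* d) :* (a :* c :- b :* d) :+ (a :* d :+ b :* c) :* (a :* d :+ b :* c)
       := (a :* a :+ b :* b) :* (c :* c :+ d :* d)) refl a b c d

  normSq-conj : ∀ x → normSq (conj x) ≡ normSq x
  normSq-conj (a +i b) = solve 2 (λ a b → a :* a :+ (:- b) :* (:- b) := a :* a :+ b :* b) refl a b

  conj⊗self≡normSq : ∀ x → conj x ⊗ x ≡ normSq x +i 0ℚ
  conj⊗self≡normSq (a +i b) = cong₂ _+i_
    (solve 2 (λ a b → a :* a :- (:- b) :* b := a :* a :+ b :* b) refl a b)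
    (solve 2 (λ a b → a :* b :+ (:- b) :* a := con 0ℚ) refl a b)

  sum-conj : ∀ m (f : Fin m → ℚi) → conj (sum f) ≡ sum (λ i → conj (f i))
  sum-conj zero f = refl
  sum-conj (suc m) f = trans (conj-⊕ (f zero) (sum (λ i → f (suc i))))
                             (cong (conj (f zero) ⊕_) (sum-conj m (λ i → f (suc i))))

  sumi≡sum : ∀ m f → sumi m f ≡ sum {m} f
  sumi≡sum zero f = refl
  sumi≡sum (suc m) f = cong (f zero ⊕_) (sumi≡sum m (λ i → f (suc i)))

  sum-supported-at : ∀ m (f : Fin m → ℚi) j → (∀ i → i ≢ j → f i ≡ 0i) → sum f ≡ f j
  sum-supported-at (suc m) f zero f≡0 = trans
    (cong (f zero ⊕_) (trans (sum-cong-≗ {m} (λ i → f≡0 (suc i) (λ ()))) (sum-replicate-zero m)))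
    (⊕-identityʳ (f zero))
  sum-supported-at (suc m) f (suc j) f≡0 = trans
    (cong₂ _⊕_ (f≡0 zero (λ ())) (sum-supported-at m (λ i → f (suc i)) j
                                   (λ i i≢j → f≡0 (suc i) (λ e → i≢j (FinP.suc-injective e)))))
    (⊕-identityˡ (f (suc j)))

  square≢-1 : ∀ a → a ℚ.* a ≢ ℚ.- 1ℚ
  square≢-1 a@(mkℚ (+ n) d c) eq =
    ℚP.nonNeg≢neg (a ℚ.* a) (ℚ.- 1ℚ) {{ℚP.nonNeg*nonNeg⇒nonNeg a a}} eq
  square≢-1 a@(mkℚ -[1+ n ] d c) eq =
    ℚP.nonNeg≢neg (-a ℚ.* -a) (ℚ.- 1ℚ) {{ℚP.nonNeg*nonNeg⇒nonNeg -a -a}}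
      (trans (solve 1 (λ a → (:- a) :* (:- a) := a :* a) refl a) eq)
    where -a = ℚ.- a

  a+a≡0⇒a≡0 : ∀ a → a ℚ.+ a ≡ 0ℚ → a ≡ 0ℚ
  a+a≡0⇒a≡0 a a+a≡0 = begin
    a                             ≡⟨ solve 1 (λ a → a := (a :+ a) :* con ½) refl a ⟩
    (a ℚ.+ a) ℚ.* ½               ≡⟨ cong (ℚ._* ½) a+a≡0 ⟩
    0ℚ ℚ.* ½                      ≡⟨ ℚP.*-zeroˡ ½ ⟩
    0ℚ                            ∎
    where
    open P.≡-Reasoning
    ½ = + 1 ℚ./ 2

  ≡⊗-1⇒≡0 : ∀ x → x ≡ x ⊗ -1i → x ≡ 0i
  ≡⊗-1⇒≡0 (a +i b) e = cong₂ _+i_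
    (a+a≡0⇒a≡0 a (trans (cong (a ℚ.+_) (cong re e))
      (solve 2 (λ a b → a :+ (a :* (:- con 1ℚ) :- b :* con 0ℚ) := con 0ℚ) refl a b)))
    (a+a≡0⇒a≡0 b (trans (cong (b ℚ.+_) (cong im e))
      (solve 2 (λ a b → b :+ (a :* con 0ℚ :+ b :* (:- con 1ℚ)) := con 0ℚ) refl a b)))

  ℕ→ℚ : ℕ → ℚ
  ℕ→ℚ zero = 0ℚ
  ℕ→ℚ (suc m) = 1ℚ ℚ.+ ℕ→ℚ m

  sum-ones : ∀ m → sum {m} (λ _ → 1i) ≡ ℕ→ℚ m +i 0ℚ
  sum-ones zero = refl
  sum-ones (suc m) = trans (cong (1i ⊕_) (sum-ones m)) (cong ((1ℚ ℚ.+ ℕ→ℚ m) +i_) (ℚP.+-identityˡ 0ℚ))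

  ℕ→ℚ≃ : ∀ m → ℚ.toℚᵘ (ℕ→ℚ m) ℚᵘ.≃ ℚᵘ.mkℚᵘ (+ m) 0
  ℕ→ℚ≃ zero = ℚᵘ.*≡* refl
  ℕ→ℚ≃ (suc m) = ℚᵘP.≃-trans (ℚP.toℚᵘ-homo-+ 1ℚ (ℕ→ℚ m))
    (ℚᵘP.≃-trans (ℚᵘP.+-cong {ℚ.toℚᵘ 1ℚ} {ℚᵘ.mkℚᵘ (+ 1) 0} (ℚᵘ.*≡* refl) (ℕ→ℚ≃ m))
      (ℚᵘ.*≡* (cong (ℤ._* + 1) (cong₂ ℤ._+_ (ℤP.*-identityʳ (+ 1)) (ℤP.*-identityʳ (+ m))))))

  1/n*1/n≡1/n*n : ∀ m .{{_ : ℕ.NonZero m}} →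
                  (+ 1 ℚ./ m) ℚ.* (+ 1 ℚ./ m) ≡ (+ 1 ℚ./ (m ℕ.* m)) {{ℕP.m*n≢0 m m}}
  1/n*1/n≡1/n*n (suc M) = ℚP.toℚᵘ-injective (ℚᵘP.≃-trans (ℚP.toℚᵘ-homo-* a a)
    (ℚᵘP.≃-trans (ℚᵘP.*-cong (ℚP.toℚᵘ-fromℚᵘ (ℚᵘ.mkℚᵘ (+ 1) M)) (ℚP.toℚᵘ-fromℚᵘ (ℚᵘ.mkℚᵘ (+ 1) M)))
      (ℚᵘP.≃-sym (ℚP.toℚᵘ-fromℚᵘ (ℚᵘ.mkℚᵘ (+ 1) (M ℕ.+ M ℕ.* suc M))))))
    where a = + 1 ℚ./ suc M

  1/n*n≡1 : ∀ m .{{_ : ℕ.NonZero m}} → (+ 1 ℚ./ m) ℚ.* ℕ→ℚ m ≡ 1ℚ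
  1/n*n≡1 (suc M) = ℚP.toℚᵘ-injective (ℚᵘP.≃-trans (ℚP.toℚᵘ-homo-* a (ℕ→ℚ (suc M)))
    (ℚᵘP.≃-trans (ℚᵘP.*-cong (ℚP.toℚᵘ-fromℚᵘ (ℚᵘ.mkℚᵘ (+ 1) M)) (ℕ→ℚ≃ (suc M)))
      (ℚᵘ.*≡* (trans (ℤP.*-identityʳ _) (trans (ℤP.*-identityˡ (+ suc M))
        (cong (λ j → + suc j) (sym (trans (ℕP.+-identityʳ (M ℕ.* 1)) (ℕP.*-identityʳ M)))))))))
    where a = + 1 ℚ./ suc M

module FourthRootOfUnity (ω : ℚi) (ω²≡-1 : ω ⊗ ω ≡ -1i) where

  open GaussianRationals
  open +-*-Solver
  open P using (refl; sym; trans)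
  open P.≡-Reasoning

  private
    a = re ω
    b = im ω

  re-ω≡0 : a ≡ 0ℚ
  re-ω≡0 with a ℚP.≟ 0ℚ
  ... | yes a≡0 = a≡0
  ... | no a≢0 = ⊥-elim (square≢-1 a (begin
      a ℚ.* a                       ≡⟨ solve 2 (λ a b → a :* a := (a :* a :- b :* b) :+ b :* b) refl a b ⟩
      (a ℚ.* a ℚ.- b ℚ.* b) ℚ.+ b ℚ.* b ≡⟨ cong₂ (λ x y → x ℚ.+ y ℚ.* y) (cong re ω²≡-1) b≡0 ⟩
      ℚ.- 1ℚ ℚ.+ 0ℚ ℚ.* 0ℚ          ≡⟨ solve 0 (:- con 1ℚ :+ con 0ℚ :* con 0ℚ := :- con 1ℚ) refl ⟩
      ℚ.- 1ℚ                        ∎))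
    where
    instance _ = ℚ.≢-nonZero a≢0
    ab≡0 : a ℚ.* b ≡ 0ℚ
    ab≡0 = a+a≡0⇒a≡0 (a ℚ.* b)
      (trans (solve 2 (λ a b → a :* b :+ a :* b := a :* b :+ b :* a) refl a b) (cong im ω²≡-1))
    b≡0 : b ≡ 0ℚ
    b≡0 = begin
      b                        ≡⟨ sym (ℚP.*-identityˡ b) ⟩
      1ℚ ℚ.* b                 ≡⟨ cong (ℚ._* b) (sym (ℚP.*-inverseˡ a)) ⟩
      (ℚ.1/ a ℚ.* a) ℚ.* b     ≡⟨ ℚP.*-assoc (ℚ.1/ a) a b ⟩
      ℚ.1/ a ℚ.* (a ℚ.* b)     ≡⟨ cong (ℚ.1/ a ℚ.*_) ab≡0 ⟩
      ℚ.1/ a ℚ.* 0ℚ            ≡⟨ ℚP.*-zeroʳ (ℚ.1/ a) ⟩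
      0ℚ                       ∎

  normSq-ω : normSq ω ≡ 1ℚ
  normSq-ω = begin
    a ℚ.* a ℚ.+ b ℚ.* b          ≡⟨ solve 2 (λ a b → a :* a :+ b :* b := :- (a :* a :- b :* b) :+ (con 1ℚ :+ con 1ℚ) :* (a :* a)) refl a b ⟩
    ℚ.- (a ℚ.* a ℚ.- b ℚ.* b) ℚ.+ (1ℚ ℚ.+ 1ℚ) ℚ.* (a ℚ.* a)
      ≡⟨ cong₂ (λ x y → ℚ.- x ℚ.+ (1ℚ ℚ.+ 1ℚ) ℚ.* (y ℚ.* y)) (cong re ω²≡-1) re-ω≡0 ⟩
    ℚ.- (ℚ.- 1ℚ) ℚ.+ (1ℚ ℚ.+ 1ℚ) ℚ.* (0ℚ ℚ.* 0ℚ) ≡⟨⟩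
    1ℚ                           ∎

  ^i-+ : ∀ m n → (ω ^i m) ⊗ (ω ^i n) ≡ ω ^i (m ℕ.+ n)
  ^i-+ zero n = ⊗-identityˡ (ω ^i n)
  ^i-+ (suc m) n = trans (⊗-assoc ω (ω ^i m) (ω ^i n)) (cong (ω ⊗_) (^i-+ m n))

  ω^4≡1 : ω ^i 4 ≡ 1i
  ω^4≡1 = begin
    ω ⊗ (ω ⊗ (ω ⊗ (ω ⊗ 1i)))   ≡⟨ cong (λ x → ω ⊗ (ω ⊗ (ω ⊗ x))) (⊗-identityʳ ω) ⟩
    ω ⊗ (ω ⊗ (ω ⊗ ω))          ≡⟨ sym (⊗-assoc ω ω (ω ⊗ ω)) ⟩
    (ω ⊗ ω) ⊗ (ω ⊗ ω)          ≡⟨ cong₂ _⊗_ ω²≡-1 ω²≡-1 ⟩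
    -1i ⊗ -1i                  ≡⟨⟩
    1i                         ∎

  ω^[4+r]≡ω^r : ∀ r → ω ^i (4 ℕ.+ r) ≡ ω ^i r
  ω^[4+r]≡ω^r r = trans (sym (^i-+ 4 r)) (trans (cong (_⊗ (ω ^i r)) ω^4≡1) (⊗-identityˡ _))

  normSq-ω^ : ∀ n → normSq (ω ^i n) ≡ 1ℚ
  normSq-ω^ zero = refl
  normSq-ω^ (suc n) = trans (normSq-⊗ ω (ω ^i n)) (cong₂ ℚ._*_ normSq-ω (normSq-ω^ n))

  conj-ω^⊗ω^≡1 : ∀ n → conj (ω ^i n) ⊗ (ω ^i n) ≡ 1i
  conj-ω^⊗ω^≡1 n = trans (conj⊗self≡normSq (ω ^i n)) (cong (_+i 0ℚ) (normSq-ω^ n))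

  infixl 6 _+₄_
  _+₄_ : Fin 4 → Fin 4 → Fin 4
  zero +₄ j = j
  suc zero +₄ zero = suc zero
  suc zero +₄ suc zero = suc (suc zero)
  suc zero +₄ suc (suc zero) = suc (suc (suc zero))
  suc zero +₄ suc (suc (suc zero)) = zero
  suc (suc zero) +₄ zero = suc (suc zero)
  suc (suc zero) +₄ suc zero = suc (suc (suc zero))
  suc (suc zero) +₄ suc (suc zero) = zero
  suc (suc zero) +₄ suc (suc (suc zero)) = suc zero
  suc (suc (suc zero)) +₄ zero = suc (suc (suc zero))
  suc (suc (suc zero)) +₄ suc zero = zero
  suc (suc (suc zero)) +₄ suc (suc zero) = suc zero
  suc (suc (suc zero)) +₄ suc (suc (suc zero)) = suc (suc zero)

  ωpow : Fin 4 → ℚi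
  ωpow j = ω ^i toℕ j

  ωpow-homo : ∀ i j → ωpow (i +₄ j) ≡ ωpow i ⊗ ωpow j
  ωpow-homo zero j = sym (⊗-identityˡ _)
  ωpow-homo (suc zero) zero = sym (^i-+ 1 0)
  ωpow-homo (suc zero) (suc zero) = sym (^i-+ 1 1)
  ωpow-homo (suc zero) (suc (suc zero)) = sym (^i-+ 1 2)
  ωpow-homo (suc zero) (suc (suc (suc zero))) = sym (trans (^i-+ 1 3) (ω^[4+r]≡ω^r 0))
  ωpow-homo (suc (suc zero)) zero = sym (^i-+ 2 0)
  ωpow-homo (suc (suc zero)) (suc zero) = sym (^i-+ 2 1)
  ωpow-homo (suc (suc zero)) (suc (suc zero)) = sym (trans (^i-+ 2 2) (ω^[4+r]≡ω^r 0))
  ωpow-homo (suc (suc zero)) (suc (suc (suc zero))) = sym (trans (^i-+ 2 3) (ω^[4+r]≡ω^r 1))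
  ωpow-homo (suc (suc (suc zero))) zero = sym (^i-+ 3 0)
  ωpow-homo (suc (suc (suc zero))) (suc zero) = sym (trans (^i-+ 3 1) (ω^[4+r]≡ω^r 0))
  ωpow-homo (suc (suc (suc zero))) (suc (suc zero)) = sym (trans (^i-+ 3 2) (ω^[4+r]≡ω^r 1))
  ωpow-homo (suc (suc (suc zero))) (suc (suc (suc zero))) = sym (trans (^i-+ 3 3) (ω^[4+r]≡ω^r 2))

  ωpow-2≡-1 : ωpow (suc (suc zero)) ≡ -1i
  ωpow-2≡-1 = trans (cong (ω ⊗_) (⊗-identityʳ ω)) ω²≡-1

module RingPowers (R : CommutativeRing 0ℓ 0ℓ) where

  open CommutativeRing R
  open RingNotions R public
  open import Algebra.Properties.CommutativeSemiring.Exp commutativeSemiring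
    using (_^_; ^-congˡ; ^-homo-*; ^-assocʳ; ^-distrib-*)
  open import Algebra.Definitions.RawMonoid +-rawMonoid public using () renaming (_×_ to _×ₙ_)
  open import Algebra.Solver.Ring.NaturalCoefficients.Default commutativeSemiring public
  open SetoidReasoning setoid

  pow≡^ : ∀ x n → pow x n ≡ x ^ n
  pow≡^ x zero = P.refl
  pow≡^ x (suc n) = cong (x *_) (pow≡^ x n)

  pow-cong : ∀ {x y} n → x ≈ y → pow x n ≈ pow y n
  pow-cong {x} {y} n x≈y rewrite pow≡^ x n | pow≡^ y n = ^-congˡ n x≈y

  pow-+ : ∀ x m n → pow x (m ℕ.+ n) ≈ pow x m * pow x n
  pow-+ x m n rewrite pow≡^ x (m ℕ.+ n) | pow≡^ x m | pow≡^ x n = ^-homo-* x m n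

  pow-* : ∀ x m n → pow x (m ℕ.* n) ≈ pow (pow x m) n
  pow-* x m n rewrite pow≡^ x (m ℕ.* n) | pow≡^ x m | pow≡^ (x ^ m) n = sym (^-assocʳ x m n)

  pow-distrib-* : ∀ x y n → pow (x * y) n ≈ pow x n * pow y n
  pow-distrib-* x y n rewrite pow≡^ (x * y) n | pow≡^ x n | pow≡^ y n = ^-distrib-* x y n

  pow-1# : ∀ n → pow 1# n ≈ 1#
  pow-1# zero = refl
  pow-1# (suc n) = trans (*-identityˡ _) (pow-1# n)

  pow-pow-comm : ∀ x m n → pow (pow x m) n ≈ pow (pow x n) m
  pow-pow-comm x m n = begin
    pow (pow x m) n   ≈⟨ pow-* x m n ⟨
    pow x (m ℕ.* n)   ≡⟨ cong (pow x) (ℕP.*-comm m n) ⟩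
    pow x (n ℕ.* m)   ≈⟨ pow-* x n m ⟩
    pow (pow x n) m   ∎

  pow-2^-suc : ∀ x m → pow x (2 ℕ.^ suc m) ≈ pow x (2 ℕ.^ m) * pow x (2 ℕ.^ m)
  pow-2^-suc x m = begin
    pow x (2 ℕ.^ suc m)                  ≡⟨ cong (λ j → pow x (2 ℕ.^ m ℕ.+ j)) (ℕP.+-identityʳ (2 ℕ.^ m)) ⟩
    pow x (2 ℕ.^ m ℕ.+ 2 ℕ.^ m)          ≈⟨ pow-+ x (2 ℕ.^ m) (2 ℕ.^ m) ⟩
    pow x (2 ℕ.^ m) * pow x (2 ℕ.^ m)    ∎

  sumR-cong : ∀ n {f g : ℕ → Carrier} → (∀ i → f i ≈ g i) → sumR n f ≈ sumR n g
  sumR-cong zero f≈g = refl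
  sumR-cong (suc n) f≈g = +-cong (sumR-cong n f≈g) (f≈g n)

  sumR-+ : ∀ n (f g : ℕ → Carrier) → sumR n (λ i → f i + g i) ≈ sumR n f + sumR n g
  sumR-+ zero f g = sym (+-identityˡ 0#)
  sumR-+ (suc n) f g = trans (+-congʳ (sumR-+ n f g))
    (solve 4 (λ a b c d → (a :+ b) :+ (c :+ d) := (a :+ c) :+ (b :+ d)) refl (sumR n f) (sumR n g) (f n) (g n))

  sumR-shift : ∀ n (f : ℕ → Carrier) → sumR n (λ i → f (suc i)) + f 0 ≈ sumR n f + f n
  sumR-shift zero f = trans (+-identityˡ _) (sym (+-identityˡ _))
  sumR-shift (suc n) f = begin
    (sumR n (λ i → f (suc i)) + f (suc n)) + f 0 ≈⟨ solve 3 (λ a b c → (a :+ b) :+ c := (a :+ c) :+ b) refl _ _ _ ⟩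
    (sumR n (λ i → f (suc i)) + f 0) + f (suc n) ≈⟨ +-congʳ (sumR-shift n f) ⟩
    (sumR n f + f n) + f (suc n)                 ∎

  sumR-const : ∀ n c → sumR n (λ _ → c) ≈ n ×ₙ c
  sumR-const zero c = refl
  sumR-const (suc n) c = trans (+-comm _ _) (+-congˡ (sumR-const n c))

  [1+2j]×ₙx≈x : ∀ x → x + x ≈ 0# → ∀ j → suc (j ℕ.+ j) ×ₙ x ≈ x
  [1+2j]×ₙx≈x x x+x≈0 zero = +-identityʳ x
  [1+2j]×ₙx≈x x x+x≈0 (suc j) = begin
    x + (suc j ℕ.+ suc j) ×ₙ x      ≡⟨ cong (λ m → x + m ×ₙ x) (ℕP.+-suc (suc j) j) ⟩
    x + (x + suc (j ℕ.+ j) ×ₙ x)    ≈⟨ +-congˡ (+-congˡ ([1+2j]×ₙx≈x x x+x≈0 j)) ⟩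
    x + (x + x)                    ≈⟨ +-congˡ x+x≈0 ⟩
    x + 0#                         ≈⟨ +-identityʳ x ⟩
    x                              ∎

module RingHomomorphismPowers
  (R S : CommutativeRing 0ℓ 0ℓ) (f : CommutativeRing.Carrier R → CommutativeRing.Carrier S)
  (isHom : RingMorphisms.IsRingHomomorphism (CommutativeRing.rawRing R) (CommutativeRing.rawRing S) f)
  where

  private
    module R = RingPowers R
    module S = RingPowers S
  open CommutativeRing S using (_≈_; trans)
  open RingMorphisms.IsRingHomomorphism isHom

  homo-pow : ∀ x n → f (R.pow x n) ≈ S.pow (f x) n
  homo-pow x zero = 1#-homo
  homo-pow x (suc n) = trans (*-homo _ _) (CommutativeRing.*-congˡ S (homo-pow x n))

module Exponents (k : ℕ) where

  n : ℕ
  n = 2 ℕ.* k ℕ.+ 1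

  h : ℕ
  h = 2 ℕ.^ (2 ℕ.* k)

  q≡h+h : qOf k ≡ h ℕ.+ h
  q≡h+h = P.trans (cong (2 ℕ.^_) (ℕP.+-comm (2 ℕ.* k) 1)) (cong (h ℕ.+_) (ℕP.+-identityʳ h))

  n≡1+[k+k] : n ≡ suc (k ℕ.+ k)
  n≡1+[k+k] = P.trans (ℕP.+-comm (2 ℕ.* k) 1) (cong (λ m → suc (k ℕ.+ m)) (ℕP.+-identityʳ k))

module CharacteristicTwoField
  (k : ℕ) (F : CommutativeRing 0ℓ 0ℓ) (isField : RingNotions.IsField F)
  (1+1≈0 : CommutativeRing._≈_ F (CommutativeRing._+_ F (CommutativeRing.1# F) (CommutativeRing.1# F))
                                 (CommutativeRing.0# F))
  (pow-q≈id : ∀ u → CommutativeRing._≈_ F (RingNotions.pow F u (qOf k)) u)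
  (_≟_ : Decidable (CommutativeRing._≈_ F))
  where

  open CommutativeRing F
  open RingPowers F
  open AbelianGroupProperties +-abelianGroup using () renaming (∙-cancelʳ to +-cancelʳ)
  open SetoidReasoning setoid
  open Exponents k

  x+2y≈x : ∀ x y → x + (1# + 1#) * y ≈ x
  x+2y≈x x y = trans (+-congˡ (trans (*-congʳ 1+1≈0) (zeroˡ y))) (+-identityʳ x)

  x+x≈0 : ∀ x → x + x ≈ 0#
  x+x≈0 x = trans (solve 1 (λ x → x :+ x := con 0 :+ (con 1 :+ con 1) :* x) refl x) (x+2y≈x 0# x)

  x+y≈0⇒x≈y : ∀ {x y} → x + y ≈ 0# → x ≈ y
  x+y≈0⇒x≈y {x} {y} x+y≈0 = begin
    x                   ≈⟨ x+2y≈x x y ⟨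
    x + (1# + 1#) * y   ≈⟨ solve 2 (λ x y → x :+ (con 1 :+ con 1) :* y := (x :+ y) :+ y) refl x y ⟩
    (x + y) + y         ≈⟨ +-congʳ x+y≈0 ⟩
    0# + y              ≈⟨ +-identityˡ y ⟩
    y                   ∎

  x≈y⇒x+y≈0 : ∀ {x y} → x ≈ y → x + y ≈ 0#
  x≈y⇒x+y≈0 {x} {y} x≈y = trans (+-congʳ x≈y) (x+x≈0 y)

  1≉0 : ¬ (1# ≈ 0#)
  1≉0 = proj₁ isField

  inverse : ∀ x → ¬ (x ≈ 0#) → Carrier
  inverse x x≉0 = proj₁ (proj₂ isField x x≉0)

  *-inverseʳ : ∀ x x≉0 → x * inverse x x≉0 ≈ 1#
  *-inverseʳ x x≉0 = proj₂ (proj₂ isField x x≉0)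

  x*y≈0⇒y≈0 : ∀ x y → ¬ (x ≈ 0#) → x * y ≈ 0# → y ≈ 0#
  x*y≈0⇒y≈0 x y x≉0 xy≈0 = begin
    y                  ≈⟨ *-identityˡ y ⟨
    1# * y             ≈⟨ *-congʳ (trans (*-comm _ _) (*-inverseʳ x x≉0)) ⟨
    (x⁻¹ * x) * y      ≈⟨ *-assoc _ _ _ ⟩
    x⁻¹ * (x * y)      ≈⟨ *-congˡ xy≈0 ⟩
    x⁻¹ * 0#           ≈⟨ zeroʳ _ ⟩
    0#                 ∎
    where x⁻¹ = inverse x x≉0

  pow-≉0 : ∀ x m → ¬ (x ≈ 0#) → ¬ (pow x m ≈ 0#)
  pow-≉0 x zero x≉0 = 1≉0
  pow-≉0 x (suc m) x≉0 xxᵐ≈0 = pow-≉0 x m x≉0 (x*y≈0⇒y≈0 x (pow x m) x≉0 xxᵐ≈0)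

  x*x≈0⇒x≈0 : ∀ x → x * x ≈ 0# → x ≈ 0#
  x*x≈0⇒x≈0 x xx≈0 with x ≟ 0#
  ... | yes x≈0 = x≈0
  ... | no x≉0 = x*y≈0⇒y≈0 x x x≉0 xx≈0

  square-+ : ∀ u v → (u + v) * (u + v) ≈ u * u + v * v
  square-+ u v = trans
    (solve 2 (λ u v → (u :+ v) :* (u :+ v) := (u :* u :+ v :* v) :+ (con 1 :+ con 1) :* (u :* v)) refl u v)
    (x+2y≈x _ _)

  pow-2^-+ : ∀ m u v → pow (u + v) (2 ℕ.^ m) ≈ pow u (2 ℕ.^ m) + pow v (2 ℕ.^ m)
  pow-2^-+ zero u v = trans (*-identityʳ _) (sym (+-cong (*-identityʳ u) (*-identityʳ v)))
  pow-2^-+ (suc m) u v = trans (pow-2^-suc _ m) (trans (*-cong (pow-2^-+ m u v) (pow-2^-+ m u v))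
    (trans (square-+ _ _) (sym (+-cong (pow-2^-suc u m) (pow-2^-suc v m)))))

  τ : Carrier → Carrier
  τ x = pow x (2 ℕ.^ k)

  τ-+ : ∀ u v → τ (u + v) ≈ τ u + τ v
  τ-+ = pow-2^-+ k

  τ-* : ∀ u v → τ (u * v) ≈ τ u * τ v
  τ-* u v = pow-distrib-* u v (2 ℕ.^ k)

  τ-1 : τ 1# ≈ 1#
  τ-1 = pow-1# (2 ℕ.^ k)

  τ-cong : ∀ {u v} → u ≈ v → τ u ≈ τ v
  τ-cong = pow-cong (2 ℕ.^ k)

  √ : Carrier → Carrier
  √ u = pow u h

  √-square : ∀ u → √ u * √ u ≈ u
  √-square u = begin
    pow u h * pow u h      ≈⟨ pow-+ u h h ⟨
    pow u (h ℕ.+ h)        ≡⟨ cong (pow u) (P.sym q≡h+h) ⟩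
    pow u (qOf k)          ≈⟨ pow-q≈id u ⟩
    u                      ∎

  √-of-square : ∀ u → √ (u * u) ≈ u
  √-of-square u = trans (pow-distrib-* u u h) (√-square u)

  τ∘τ≈√ : ∀ x → τ (τ x) ≈ √ x
  τ∘τ≈√ x = begin
    pow (pow x (2 ℕ.^ k)) (2 ℕ.^ k)      ≈⟨ pow-* x (2 ℕ.^ k) (2 ℕ.^ k) ⟨
    pow x (2 ℕ.^ k ℕ.* 2 ℕ.^ k)          ≡⟨ cong (pow x) (P.sym (ℕP.^-distribˡ-+-* 2 k k)) ⟩
    pow x (2 ℕ.^ (k ℕ.+ k))              ≡⟨ cong (λ j → pow x (2 ℕ.^ (k ℕ.+ j))) (P.sym (ℕP.+-identityʳ k)) ⟩
    √ x                                  ∎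

  tr : Carrier → Carrier
  tr u = sumR n (λ i → pow u (2 ℕ.^ i))

  tr-cong : ∀ {u v} → u ≈ v → tr u ≈ tr v
  tr-cong u≈v = sumR-cong n (λ i → pow-cong (2 ℕ.^ i) u≈v)

  tr-+ : ∀ u v → tr (u + v) ≈ tr u + tr v
  tr-+ u v = trans (sumR-cong n (λ i → pow-2^-+ i u v)) (sumR-+ n _ _)

  tr-square : ∀ u → tr (u * u) ≈ tr u
  tr-square u = +-cancelʳ (pow u 1) _ _ (begin
    tr (u * u) + pow u 1                           ≈⟨ +-congʳ (sumR-cong n (λ i →
                                                        trans (pow-distrib-* u u (2 ℕ.^ i)) (sym (pow-2^-suc u i)))) ⟩
    sumR n (λ i → pow u (2 ℕ.^ suc i)) + pow u 1   ≈⟨ sumR-shift n (λ i → pow u (2 ℕ.^ i)) ⟩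
    tr u + pow u (2 ℕ.^ n)                         ≈⟨ +-congˡ (trans (pow-q≈id u) (sym (*-identityʳ u))) ⟩
    tr u + pow u 1                                 ∎)

  tr-pow-2^ : ∀ j u → tr (pow u (2 ℕ.^ j)) ≈ tr u
  tr-pow-2^ zero u = tr-cong (*-identityʳ u)
  tr-pow-2^ (suc j) u = trans (tr-cong (pow-2^-suc u j)) (trans (tr-square _) (tr-pow-2^ j u))

  tr-τ : ∀ u → tr (τ u) ≈ tr u
  tr-τ = tr-pow-2^ k

  tr-1 : tr 1# ≈ 1#
  tr-1 = begin
    tr 1#                    ≈⟨ sumR-cong n (λ i → pow-1# (2 ℕ.^ i)) ⟩
    sumR n (λ _ → 1#)        ≈⟨ sumR-const n 1# ⟩
    n ×ₙ 1#                  ≡⟨ cong (_×ₙ 1#) n≡1+[k+k] ⟩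
    suc (k ℕ.+ k) ×ₙ 1#      ≈⟨ [1+2j]×ₙx≈x 1# 1+1≈0 k ⟩
    1#                       ∎

  offDiag : Carrier → Carrier → Carrier
  offDiag α β = τ α + β * τ β

  offDiag-sum : ∀ α β α' β' → offDiag α β + offDiag α' β' ≈ τ (α + α') + (β * τ β + β' * τ β')
  offDiag-sum α β α' β' = trans
    (solve 4 (λ a a' x y → (a :+ x) :+ (a' :+ y) := (a :+ a') :+ (x :+ y)) refl (τ α) (τ α') _ _)
    (+-congʳ (sym (τ-+ α α')))

  det≈0⇒α≈α′-when-β≈β′ : ∀ α β α' β' → β + β' ≈ 0# →
    (α + α') * (β + β') ≈ (offDiag α β + offDiag α' β') * (offDiag α β + offDiag α' β') → α ≈ α'
  det≈0⇒α≈α′-when-β≈β′ α β α' β' B≈0 det≈0 = x+y≈0⇒x≈y A≈0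
    where
    A = α + α'
    S = offDiag α β + offDiag α' β'
    β≈β' : β ≈ β'
    β≈β' = x+y≈0⇒x≈y B≈0
    S≈τA : S ≈ τ A
    S≈τA = begin
      S                                    ≈⟨ offDiag-sum α β α' β' ⟩
      τ A + (β * τ β + β' * τ β')          ≈⟨ +-congˡ (x≈y⇒x+y≈0 (*-cong β≈β' (τ-cong β≈β'))) ⟩
      τ A + 0#                             ≈⟨ +-identityʳ _ ⟩
      τ A                                  ∎
    S≈0 : S ≈ 0#
    S≈0 = x*x≈0⇒x≈0 S (trans (sym det≈0) (trans (*-congˡ B≈0) (zeroʳ _)))
    A≈0 : A ≈ 0#
    A≈0 with A ≟ 0#
    ... | yes A≈0 = A≈0
    ... | no A≉0 = ⊥-elim (pow-≉0 A (2 ℕ.^ k) A≉0 (trans (sym S≈τA) S≈0))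

  -- With B = β + β' ≠ 0, I = B⁻¹ and J = (τ B)⁻¹, the trace of I J (τ A + K) cannot vanish:
  -- tr (I J K) = tr (β I + τ (β I) + 1) = 1, whereas A B = S² forces tr (I J τ A) = tr (I J S).
  module DistinctSecondCoordinates (α β α' β' : Carrier) (B≉0 : ¬ (β + β' ≈ 0#)) where

    A = α + α'
    B = β + β'
    K = β * τ β + β' * τ β'
    S = offDiag α β + offDiag α' β'
    τB≉0 : ¬ (τ B ≈ 0#)
    τB≉0 = pow-≉0 B (2 ℕ.^ k) B≉0
    I = inverse B B≉0
    J = inverse (τ B) τB≉0
    BI≈1 : B * I ≈ 1#
    BI≈1 = *-inverseʳ B B≉0
    τBJ≈1 : τ B * J ≈ 1#
    τBJ≈1 = *-inverseʳ (τ B) τB≉0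

    τ-inverse : ∀ x y → x * y ≈ 1# → τ x * τ y ≈ 1#
    τ-inverse x y xy≈1 = trans (sym (τ-* x y)) (trans (τ-cong xy≈1) τ-1)

    τI≈J : τ I ≈ J
    τI≈J = begin
      τ I                 ≈⟨ *-identityʳ _ ⟨
      τ I * 1#            ≈⟨ *-congˡ τBJ≈1 ⟨
      τ I * (τ B * J)     ≈⟨ *-assoc _ _ _ ⟨
      (τ I * τ B) * J     ≈⟨ *-congʳ (τ-inverse I B (trans (*-comm I B) BI≈1)) ⟩
      1# * J              ≈⟨ *-identityˡ J ⟩
      J                   ∎

    τJ²≈I : τ J * τ J ≈ I
    τJ²≈I = begin
      τ J * τ J                                   ≈⟨ *-identityʳ _ ⟨
      τ J * τ J * 1#                              ≈⟨ *-congˡ BI≈1 ⟨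
      τ J * τ J * (B * I)                         ≈⟨ *-congˡ (*-congʳ (trans (*-cong (τ∘τ≈√ B) (τ∘τ≈√ B)) (√-square B))) ⟨
      τ J * τ J * (τ (τ B) * τ (τ B) * I)         ≈⟨ solve 3 (λ x y i → x :* x :* (y :* y :* i) := (x :* y) :* (x :* y) :* i) refl (τ J) (τ (τ B)) I ⟩
      (τ J * τ (τ B)) * (τ J * τ (τ B)) * I       ≈⟨ *-congʳ (*-cong τJττB≈1 τJττB≈1) ⟩
      1# * 1# * I                                 ≈⟨ trans (*-congʳ (*-identityˡ 1#)) (*-identityˡ I) ⟩
      I                                           ∎
      where
      τJττB≈1 : τ J * τ (τ B) ≈ 1#
      τJττB≈1 = τ-inverse J (τ B) (trans (*-comm J (τ B)) τBJ≈1)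

    tr-IJK≈1 : tr (I * J * K) ≈ 1#
    tr-IJK≈1 = begin
      tr (I * J * K)                            ≈⟨ tr-cong IJK≈ ⟩
      tr (β * I + τ (β * I) + 1#)               ≈⟨ trans (tr-+ _ _) (+-congʳ (tr-+ _ _)) ⟩
      tr (β * I) + tr (τ (β * I)) + tr 1#       ≈⟨ +-cong (+-congˡ (tr-τ _)) tr-1 ⟩
      tr (β * I) + tr (β * I) + 1#              ≈⟨ +-congʳ (x+x≈0 _) ⟩
      0# + 1#                                   ≈⟨ +-identityˡ 1# ⟩
      1#                                        ∎
      where
      β'≈β+B : β' ≈ β + B
      β'≈β+B = trans (sym (x+2y≈x β' β)) (solve 2 (λ b b' → b' :+ (con 1 :+ con 1) :* b := b :+ (b :+ b')) refl β β')
      K≈ : K ≈ β * τ B + B * τ β + B * τ B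
      K≈ = begin
        β * τ β + β' * τ β'                           ≈⟨ +-congˡ (*-cong β'≈β+B (trans (τ-cong β'≈β+B) (τ-+ β B))) ⟩
        β * τ β + (β + B) * (τ β + τ B)               ≈⟨ solve 4 (λ b B x y → b :* x :+ (b :+ B) :* (x :+ y)
                                                            := (b :* y :+ B :* x :+ B :* y) :+ (con 1 :+ con 1) :* (b :* x)) refl β B (τ β) (τ B) ⟩
        (β * τ B + B * τ β + B * τ B) + (1# + 1#) * (β * τ β) ≈⟨ x+2y≈x _ _ ⟩
        β * τ B + B * τ β + B * τ B                   ∎
      IJK≈ : I * J * K ≈ β * I + τ (β * I) + 1#
      IJK≈ = begin
        I * J * K                                                       ≈⟨ *-congˡ K≈ ⟩
        I * J * (β * τ B + B * τ β + B * τ B)                           ≈⟨ solve 6 (λ i j b B x y → i :* j :* (b :* y :+ B :* x :+ B :* y)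
                                                                            := (b :* i) :* (y :* j) :+ (x :* j) :* (B :* i) :+ (B :* i) :* (y :* j)) refl I J β B (τ β) (τ B) ⟩
        (β * I) * (τ B * J) + (τ β * J) * (B * I) + (B * I) * (τ B * J) ≈⟨ +-cong (+-cong (*-congˡ τBJ≈1) (*-congˡ BI≈1)) (*-cong BI≈1 τBJ≈1) ⟩
        (β * I) * 1# + (τ β * J) * 1# + 1# * 1#                         ≈⟨ +-cong (+-cong (*-identityʳ _) (trans (*-identityʳ _) (*-congˡ (sym τI≈J)))) (*-identityˡ 1#) ⟩
        β * I + τ β * τ I + 1#                                          ≈⟨ +-congʳ (+-congˡ (sym (τ-* β I))) ⟩
        β * I + τ (β * I) + 1#                                          ∎

    tr-IJτA≈tr-IJS : A * B ≈ S * S → tr (I * J * τ A) ≈ tr (I * J * S)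
    tr-IJτA≈tr-IJS AB≈S² = sym (begin
      tr y                                          ≈⟨ tr-τ y ⟨
      tr (τ y)                                      ≈⟨ tr-square (τ y) ⟨
      tr (τ y * τ y)                                ≈⟨ tr-cong (*-cong τy≈ τy≈) ⟩
      tr ((J * τ J * τ S) * (J * τ J * τ S))        ≈⟨ tr-cong (solve 3 (λ j t s → (j :* t :* s) :* (j :* t :* s)
                                                          := (t :* t) :* j :* (s :* s :* j)) refl J (τ J) (τ S)) ⟩
      tr ((τ J * τ J) * J * (τ S * τ S * J))        ≈⟨ tr-cong (*-cong (*-congʳ τJ²≈I) (sym τA≈)) ⟩
      tr (I * J * τ A)                              ∎)
      where
      y = I * J * S
      τy≈ : τ y ≈ J * τ J * τ S
      τy≈ = trans (τ-* (I * J) S) (*-congʳ (trans (τ-* I J) (*-congʳ τI≈J)))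
      τA≈ : τ A ≈ τ S * τ S * J
      τA≈ = begin
        τ A                  ≈⟨ *-identityʳ _ ⟨
        τ A * 1#             ≈⟨ *-congˡ τBJ≈1 ⟨
        τ A * (τ B * J)      ≈⟨ *-assoc _ _ _ ⟨
        (τ A * τ B) * J      ≈⟨ *-congʳ (trans (sym (τ-* A B)) (trans (τ-cong AB≈S²) (τ-* S S))) ⟩
        τ S * τ S * J        ∎

    det≉0 : ¬ (A * B ≈ S * S)
    det≉0 AB≈S² = 1≉0 (+-cancelʳ (tr (I * J * S)) _ _ (begin
      1# + tr (I * J * S)                      ≈⟨ +-comm _ _ ⟩
      tr (I * J * S) + 1#                      ≈⟨ +-cong (tr-IJτA≈tr-IJS AB≈S²) tr-IJK≈1 ⟨
      tr (I * J * τ A) + tr (I * J * K)        ≈⟨ tr-+ _ _ ⟨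
      tr (I * J * τ A + I * J * K)             ≈⟨ tr-cong (distribˡ _ _ _) ⟨
      tr (I * J * (τ A + K))                   ≈⟨ tr-cong (*-congˡ (offDiag-sum α β α' β')) ⟨
      tr (I * J * S)                           ≈⟨ +-identityˡ _ ⟨
      0# + tr (I * J * S)                      ∎))

  det≉0 : ∀ α β α' β' → ¬ (α ≈ α' × β ≈ β') →
    ¬ ((α + α') * (β + β') ≈ (offDiag α β + offDiag α' β') * (offDiag α β + offDiag α' β'))
  det≉0 α β α' β' c≉c' det≈0 with (β + β') ≟ 0#
  ... | yes B≈0 = c≉c' (det≈0⇒α≈α′-when-β≈β′ α β α' β' B≈0 det≈0 , x+y≈0⇒x≈y B≈0)
  ... | no B≉0 = DistinctSecondCoordinates.det≉0 α β α' β' B≉0 det≈0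

  symmetric-kernel-trivial : ∀ A B S y₁ y₂ → ¬ (A * B ≈ S * S) →
    A * y₁ + S * y₂ ≈ 0# → S * y₁ + B * y₂ ≈ 0# → y₁ ≈ 0# × y₂ ≈ 0#
  symmetric-kernel-trivial A B S y₁ y₂ det≉0 e₁ e₂ =
    x*y≈0⇒y≈0 d y₁ d≉0 dy₁≈0 , x*y≈0⇒y≈0 d y₂ d≉0 dy₂≈0
    where
    d = A * B + S * S
    d≉0 : ¬ (d ≈ 0#)
    d≉0 d≈0 = det≉0 (x+y≈0⇒x≈y d≈0)
    dy₁≈0 : d * y₁ ≈ 0#
    dy₁≈0 = begin
      d * y₁                                            ≈⟨ x+2y≈x _ _ ⟨
      d * y₁ + (1# + 1#) * (S * B * y₂)                 ≈⟨ solve 5 (λ A B S y₁ y₂ → (A :* B :+ S :* S) :* y₁ :+ (con 1 :+ con 1) :* (S :* B :* y₂)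
                                                             := B :* (A :* y₁ :+ S :* y₂) :+ S :* (S :* y₁ :+ B :* y₂)) refl A B S y₁ y₂ ⟩
      B * (A * y₁ + S * y₂) + S * (S * y₁ + B * y₂)     ≈⟨ +-cong (*-congˡ e₁) (*-congˡ e₂) ⟩
      B * 0# + S * 0#                                   ≈⟨ trans (+-cong (zeroʳ B) (zeroʳ S)) (+-identityʳ 0#) ⟩
      0#                                                ∎
    dy₂≈0 : d * y₂ ≈ 0#
    dy₂≈0 = begin
      d * y₂                                            ≈⟨ x+2y≈x _ _ ⟨
      d * y₂ + (1# + 1#) * (A * S * y₁)                 ≈⟨ solve 5 (λ A B S y₁ y₂ → (A :* B :+ S :* S) :* y₂ :+ (con 1 :+ con 1) :* (A :* S :* y₁)
                                                             := A :* (S :* y₁ :+ B :* y₂) :+ S :* (A :* y₁ :+ S :* y₂)) refl A B S y₁ y₂ ⟩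
      A * (S * y₁ + B * y₂) + S * (A * y₁ + S * y₂)     ≈⟨ +-cong (*-congˡ e₂) (*-congˡ e₁) ⟩
      A * 0# + S * 0#                                   ≈⟨ trans (+-cong (zeroʳ A) (zeroʳ S)) (+-identityʳ 0#) ⟩
      0#                                                ∎

module MutuallyUnbiasedBases
  (k : ℕ)
  (F : CommutativeRing 0ℓ 0ℓ) (isField : RingNotions.IsField F)
  (enumF : Fin (qOf k) → CommutativeRing.Carrier F)
  (isEnum : RingNotions.IsEnumeration F (qOf k) enumF)
  (R : CommutativeRing 0ℓ 0ℓ)
  (_≈R?_ : Decidable (CommutativeRing._≈_ R))
  (hasChar4 : RingNotions.HasChar4 R)
  (π : CommutativeRing.Carrier R → CommutativeRing.Carrier F)
  (isHom : RingMorphisms.IsRingHomomorphism (CommutativeRing.rawRing R) (CommutativeRing.rawRing F) π)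
  (kerπ : ∀ x → (CommutativeRing._≈_ F (π x) (CommutativeRing.0# F) →
                  ∃ λ y → CommutativeRing._≈_ R x (CommutativeRing._*_ R (RingNotions.two R) y))
              × ((∃ λ y → CommutativeRing._≈_ R x (CommutativeRing._*_ R (RingNotions.two R) y)) →
                  CommutativeRing._≈_ F (π x) (CommutativeRing.0# F)))
  (hat : CommutativeRing.Carrier F → CommutativeRing.Carrier R)
  (isLift : ∀ u → RingNotions.InTeich R (qOf k) (hat u) × CommutativeRing._≈_ F (π (hat u)) u)
  (decomp : CommutativeRing.Carrier R → CommutativeRing.Carrier R × CommutativeRing.Carrier R)
  (isDecomp : ∀ x → RingNotions.InTeich R (qOf k) (proj₁ (decomp x))
                  × RingNotions.InTeich R (qOf k) (proj₂ (decomp x))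
                  × CommutativeRing._≈_ R x
                      (CommutativeRing._+_ R (proj₁ (decomp x))
                        (CommutativeRing._*_ R (RingNotions.two R) (proj₂ (decomp x)))))
  (ω : ℚi) (ω²≡-1 : ω ⊗ ω ≡ -1i)
  where

  module C = Construction k F enumF R _≈R?_ hat decomp ω
  open C using (q)
  module R where
    open CommutativeRing R public
    open RingPowers R public
    open AbelianGroupProperties +-abelianGroup public using () renaming (∙-cancelˡ to +-cancelˡ; ∙-cancelʳ to +-cancelʳ)
  module F where
    open CommutativeRing F public
    open RingPowers F public
    open AbelianGroupProperties +-abelianGroup public using (x∙y⁻¹≈ε⇒x≈y)
  module πᴴ = RingHomomorphismPowers R F π isHom
  open RingMorphisms.IsRingHomomorphism isHom
  open R using (_≈_; _+_; _*_; -_; 0#; 1#; pow; two)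
  open GaussianRationals
  open FourthRootOfUnity ω ω²≡-1
  open Exponents k

  h′ : ℕ
  h′ = h ℕ.∸ 1

  q∸1≡1+[h′+h′] : q ℕ.∸ 1 ≡ suc (h′ ℕ.+ h′)
  q∸1≡1+[h′+h′] = P.trans (cong (ℕ._∸ 1) (P.trans q≡h+h (cong₂ ℕ._+_ h≡1+h′ h≡1+h′))) (ℕP.+-suc h′ h′)
    where
    h≡1+h′ : h ≡ suc h′
    h≡1+h′ = P.sym (ℕP.suc-pred h {{ℕP.m^n≢0 2 (2 ℕ.* k)}})

  2+2≈0 : two + two ≈ 0#
  2+2≈0 = proj₁ hasChar4

  2≉0 : ¬ (two ≈ 0#)
  2≉0 = proj₂ hasChar4

  1≉0 : ¬ (1# ≈ 0#)
  1≉0 1≈0 = 2≉0 (R.trans (R.+-cong 1≈0 1≈0) (R.+-identityˡ 0#))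

  2*[2*x]≈0 : ∀ x → two * (two * x) ≈ 0#
  2*[2*x]≈0 x = R.trans (R.sym (R.*-assoc two two x))
    (R.trans (R.*-congʳ (R.trans (R.solve 0 (R.con 2 R.:* R.con 2 R.:= R.con 2 R.:+ R.con 2) R.refl) 2+2≈0)) (R.zeroˡ x))

  2x+2x≈0 : ∀ x → two * x + two * x ≈ 0#
  2x+2x≈0 x = R.trans (R.sym (R.distribʳ x two two)) (R.trans (R.*-congʳ 2+2≈0) (R.zeroˡ x))

  π[2x]≈0 : ∀ x → π (two * x) F.≈ F.0#
  π[2x]≈0 x = proj₂ (kerπ (two * x)) (x , R.refl)

  π[a+2y]≈πa : ∀ a y → π (a + two * y) F.≈ π a
  π[a+2y]≈πa a y = F.trans (+-homo _ _) (F.trans (F.+-congˡ (π[2x]≈0 y)) (F.+-identityʳ _))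

  1+1≈0ᶠ : F.1# F.+ F.1# F.≈ F.0#
  1+1≈0ᶠ = F.trans (F.sym (F.trans (+-homo 1# 1#) (F.+-cong 1#-homo 1#-homo)))
                   (F.trans (⟦⟧-cong (R.sym (R.*-identityʳ two))) (π[2x]≈0 1#))

  πx≈πy⇒x≈y+2z : ∀ x y → π x F.≈ π y → ∃ λ z → x ≈ y + two * z
  πx≈πy⇒x≈y+2z x y πx≈πy with proj₁ (kerπ (x + - y)) π[x-y]≈0
    where
    π[x-y]≈0 : π (x + - y) F.≈ F.0#
    π[x-y]≈0 = F.trans (+-homo x (- y)) (F.trans (F.+-cong πx≈πy (-‿homo y)) (F.-‿inverseʳ (π y)))
  ... | z , x-y≈2z = z , (begin
    x                 ≈⟨ R.+-identityˡ x ⟨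
    0# + x            ≈⟨ R.+-congʳ (R.-‿inverseʳ y) ⟨
    (y + - y) + x     ≈⟨ R.+-assoc y _ x ⟩
    y + (- y + x)     ≈⟨ R.+-congˡ (R.+-comm _ x) ⟩
    y + (x + - y)     ≈⟨ R.+-congˡ x-y≈2z ⟩
    y + two * z       ∎)
    where open SetoidReasoning R.setoid

  [c+2z]²≈c² : ∀ c z → (c + two * z) * (c + two * z) ≈ c * c
  [c+2z]²≈c² c z = begin
    (c + two * z) * (c + two * z)                          ≈⟨ R.solve 2 (λ c z → (c :+ con 2 :* z) :* (c :+ con 2 :* z)
                                                                := c :* c :+ (con 2 :* (con 2 :* (c :* z)) :+ con 2 :* (con 2 :* (z :* z)))) R.refl c z ⟩
    c * c + (two * (two * (c * z)) + two * (two * (z * z))) ≈⟨ R.+-congˡ (R.+-cong (2*[2*x]≈0 _) (2*[2*x]≈0 _)) ⟩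
    c * c + (0# + 0#)                                      ≈⟨ R.trans (R.+-congˡ (R.+-identityˡ 0#)) (R.+-identityʳ _) ⟩
    c * c                                                  ∎
    where
    open SetoidReasoning R.setoid
    open R using (con; _:*_; _:+_; _:=_)

  -- (t + 2y)^(2j+1) = t^(2j+1) + 2 y t^(2j): all higher terms of the binomial expansion carry a factor 4.
  pow-odd-[t+2y] : ∀ t y j → pow (t + two * y) (suc (j ℕ.+ j)) ≈ pow t (suc (j ℕ.+ j)) + two * y * pow t (j ℕ.+ j)
  pow-odd-[t+2y] t y zero = R.solve 2 (λ t y → (t :+ con 2 :* y) :* con 1 := t :* con 1 :+ con 2 :* y :* con 1) R.refl t y
    where open R using (con; _:*_; _:+_; _:=_)
  pow-odd-[t+2y] t y (suc j) = begin
    pow x (suc (suc j ℕ.+ suc j))                                    ≡⟨ cong (pow x) 2j+3≡2+[2j+1] ⟩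
    pow x (2 ℕ.+ suc (j ℕ.+ j))                                      ≈⟨ R.pow-+ x 2 (suc (j ℕ.+ j)) ⟩
    pow x 2 * pow x (suc (j ℕ.+ j))                                  ≈⟨ R.*-cong (R.trans (R.*-congˡ (R.*-identityʳ x)) ([c+2z]²≈c² t y))
                                                                                  (pow-odd-[t+2y] t y j) ⟩
    (t * t) * (pow t (suc (j ℕ.+ j)) + two * y * pow t (j ℕ.+ j))    ≈⟨ R.solve 4 (λ t y a b → (t :* t) :* (a :+ con 2 :* y :* b)
                                                                          := t :* (t :* a) :+ con 2 :* y :* (t :* (t :* b))) R.refl t y _ _ ⟩
    pow t (2 ℕ.+ suc (j ℕ.+ j)) + two * y * pow t (2 ℕ.+ (j ℕ.+ j)) ≡⟨ cong₂ (λ a b → pow t a + two * y * pow t b)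
                                                                          (P.sym 2j+3≡2+[2j+1]) (P.sym (cong suc (ℕP.+-suc j j))) ⟩
    pow t (suc (suc j ℕ.+ suc j)) + two * y * pow t (suc j ℕ.+ suc j) ∎
    where
    open SetoidReasoning R.setoid
    open R using (con; _:*_; _:+_; _:=_)
    x = t + two * y
    2j+3≡2+[2j+1] : suc (suc j ℕ.+ suc j) ≡ 2 ℕ.+ suc (j ℕ.+ j)
    2j+3≡2+[2j+1] = cong (λ m → suc (suc m)) (ℕP.+-suc j j)

  -- Teichmüller representatives

  Teich : R.Carrier → Set
  Teich = R.InTeich q

  pow-[q∸1] : ∀ t → pow t (q ℕ.∸ 1) ≈ t * pow t (h′ ℕ.+ h′)
  pow-[q∸1] t = P.subst (λ m → pow t m ≈ t * pow t (h′ ℕ.+ h′)) (P.sym q∸1≡1+[h′+h′]) R.refl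

  2t≉0 : ∀ t → pow t (q ℕ.∸ 1) ≈ 1# → ¬ (two * t ≈ 0#)
  2t≉0 t tᵠ≈1 2t≈0 = 2≉0 (begin
    two                                    ≈⟨ R.*-identityʳ two ⟨
    two * 1#                               ≈⟨ R.*-congˡ tᵠ≈1 ⟨
    two * pow t (q ℕ.∸ 1)                  ≈⟨ R.*-congˡ (pow-[q∸1] t) ⟩
    two * (t * pow t (h′ ℕ.+ h′))          ≈⟨ R.*-assoc two t _ ⟨
    (two * t) * pow t (h′ ℕ.+ h′)          ≈⟨ R.*-congʳ 2t≈0 ⟩
    0# * pow t (h′ ℕ.+ h′)                 ≈⟨ R.zeroˡ _ ⟩
    0#                                     ∎)
    where open SetoidReasoning R.setoid

  2x≈0⇒πx≈0 : ∀ x → two * x ≈ 0# → π x F.≈ F.0#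
  2x≈0⇒πx≈0 x 2x≈0 with isDecomp x
  ... | inj₁ a≈0 , _ , x≈a+2b =
    F.trans (⟦⟧-cong (R.trans x≈a+2b (R.trans (R.+-congʳ a≈0) (R.+-identityˡ _)))) (π[2x]≈0 _)
  ... | inj₂ aᵠ≈1 , _ , x≈a+2b = ⊥-elim (2t≉0 a aᵠ≈1 (begin
    two * a                           ≈⟨ R.+-identityʳ _ ⟨
    two * a + 0#                      ≈⟨ R.+-congˡ (2*[2*x]≈0 b) ⟨
    two * a + two * (two * b)         ≈⟨ R.distribˡ two a _ ⟨
    two * (a + two * b)               ≈⟨ R.*-congˡ x≈a+2b ⟨
    two * x                           ≈⟨ 2x≈0 ⟩
    0#                                ∎))
    where
    open SetoidReasoning R.setoid
    a = proj₁ (decomp x)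
    b = proj₂ (decomp x)

  Teich-π≈0⇒≈0 : ∀ t → Teich t → π t F.≈ F.0# → t ≈ 0#
  Teich-π≈0⇒≈0 t (inj₁ t≈0) _ = t≈0
  Teich-π≈0⇒≈0 t (inj₂ tᵠ≈1) πt≈0 with proj₁ (kerπ t) πt≈0
  ... | y , t≈2y = ⊥-elim (2t≉0 t tᵠ≈1 (R.trans (R.*-congˡ t≈2y) (2*[2*x]≈0 y)))

  Teich-π-injective : ∀ t t′ → Teich t → Teich t′ → π t F.≈ π t′ → t ≈ t′
  Teich-π-injective t t′ (inj₁ t≈0) Tt′ πt≈πt′ =
    R.trans t≈0 (R.sym (Teich-π≈0⇒≈0 t′ Tt′ (F.trans (F.sym πt≈πt′) (F.trans (⟦⟧-cong t≈0) 0#-homo))))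
  Teich-π-injective t t′ (inj₂ tᵠ≈1) (inj₁ t′≈0) πt≈πt′ =
    R.trans (Teich-π≈0⇒≈0 t (inj₂ tᵠ≈1) (F.trans πt≈πt′ (F.trans (⟦⟧-cong t′≈0) 0#-homo))) (R.sym t′≈0)
  Teich-π-injective t t′ (inj₂ tᵠ≈1) (inj₂ t′ᵠ≈1) πt≈πt′ with πx≈πy⇒x≈y+2z t t′ πt≈πt′
  ... | y , t≈t′+2y = R.trans t≈t′+2y (R.trans (R.+-congˡ 2y≈0) (R.+-identityʳ t′))
    where
    open SetoidReasoning R.setoid
    p = pow t′ (h′ ℕ.+ h′)
    1+2yp≈1+0 : 1# + two * y * p ≈ 1# + 0#
    1+2yp≈1+0 = begin
      1# + two * y * p                      ≈⟨ R.+-congʳ t′ᵠ≈1 ⟨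
      pow t′ (q ℕ.∸ 1) + two * y * p        ≡⟨ cong (λ m → pow t′ m + two * y * p) q∸1≡1+[h′+h′] ⟩
      pow t′ (suc (h′ ℕ.+ h′)) + two * y * p ≈⟨ pow-odd-[t+2y] t′ y h′ ⟨
      pow (t′ + two * y) (suc (h′ ℕ.+ h′))  ≈⟨ R.pow-cong (suc (h′ ℕ.+ h′)) t≈t′+2y ⟨
      pow t (suc (h′ ℕ.+ h′))               ≡⟨ cong (pow t) q∸1≡1+[h′+h′] ⟨
      pow t (q ℕ.∸ 1)                       ≈⟨ tᵠ≈1 ⟩
      1#                                    ≈⟨ R.+-identityʳ 1# ⟨
      1# + 0#                               ∎
    2y≈0 : two * y ≈ 0#
    2y≈0 = begin
      two * y                               ≈⟨ R.*-identityʳ _ ⟨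
      two * y * 1#                          ≈⟨ R.*-congˡ t′ᵠ≈1 ⟨
      two * y * pow t′ (q ℕ.∸ 1)            ≈⟨ R.*-congˡ (R.trans (pow-[q∸1] t′) (R.*-comm t′ p)) ⟩
      two * y * (p * t′)                    ≈⟨ R.*-assoc _ p t′ ⟨
      two * y * p * t′                      ≈⟨ R.*-congʳ (R.+-cancelˡ 1# _ _ 1+2yp≈1+0) ⟩
      0# * t′                               ≈⟨ R.zeroˡ t′ ⟩
      0#                                    ∎

  Teich-0 : Teich 0#
  Teich-0 = inj₁ R.refl

  Teich-1 : Teich 1#
  Teich-1 = inj₂ (R.pow-1# (q ℕ.∸ 1))

  Teich-* : ∀ a b → Teich a → Teich b → Teich (a * b)
  Teich-* a b (inj₁ a≈0) _ = inj₁ (R.trans (R.*-congʳ a≈0) (R.zeroˡ b))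
  Teich-* a b (inj₂ _) (inj₁ b≈0) = inj₁ (R.trans (R.*-congˡ b≈0) (R.zeroʳ a))
  Teich-* a b (inj₂ aᵠ≈1) (inj₂ bᵠ≈1) =
    inj₂ (R.trans (R.pow-distrib-* a b (q ℕ.∸ 1)) (R.trans (R.*-cong aᵠ≈1 bᵠ≈1) (R.*-identityˡ 1#)))

  Teich-pow : ∀ a m → Teich a → Teich (pow a m)
  Teich-pow a zero _ = Teich-1
  Teich-pow a (suc m) Ta = Teich-* a (pow a m) Ta (Teich-pow a m Ta)

  Teich-pow-q : ∀ t → Teich t → pow t q ≈ t
  Teich-pow-q t Tt = P.subst (λ m → pow t m ≈ t) (P.sym q≡1+[q∸1]) (t*tᵠ≈t Tt)
    where
    q≡1+[q∸1] : q ≡ suc (q ℕ.∸ 1)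
    q≡1+[q∸1] = P.sym (ℕP.suc-pred q {{qOf-nonZero k}})
    t*tᵠ≈t : Teich t → t * pow t (q ℕ.∸ 1) ≈ t
    t*tᵠ≈t (inj₁ t≈0) = R.trans (R.*-congʳ t≈0) (R.trans (R.zeroˡ _) (R.sym t≈0))
    t*tᵠ≈t (inj₂ tᵠ≈1) = R.trans (R.*-congˡ tᵠ≈1) (R.*-identityʳ t)

  Teich-square-root : ∀ t → Teich t → pow t h * pow t h ≈ t
  Teich-square-root t Tt = R.trans (R.sym (R.pow-+ t h h))
    (R.trans (P.subst (λ m → pow t m ≈ pow t q) q≡h+h R.refl) (Teich-pow-q t Tt))

  Teich-idempotent : ∀ t → Teich t → pow t 2 ≈ t → (t ≈ 0#) ⊎ (t ≈ 1#)
  Teich-idempotent t (inj₁ t≈0) _ = inj₁ t≈0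
  Teich-idempotent t (inj₂ tᵠ≈1) t²≈t =
    inj₂ (R.sym (R.trans (R.sym tᵠ≈1) (R.trans (P.subst (λ m → pow t (q ℕ.∸ 1) ≈ pow t m) q∸1≡1+[h′+h′] R.refl) (tᵐ⁺¹≈t (h′ ℕ.+ h′)))))
    where
    tᵐ⁺¹≈t : ∀ j → pow t (suc j) ≈ t
    tᵐ⁺¹≈t zero = R.*-identityʳ t
    tᵐ⁺¹≈t (suc j) = R.trans (R.*-congˡ (tᵐ⁺¹≈t j)) (R.trans (R.*-congˡ (R.sym (R.*-identityʳ t))) t²≈t)

  hat-Teich : ∀ u → Teich (hat u)
  hat-Teich u = proj₁ (isLift u)

  π-hat : ∀ u → π (hat u) F.≈ u
  π-hat u = proj₂ (isLift u)

  hat-cong : ∀ {u v} → u F.≈ v → hat u ≈ hat v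
  hat-cong {u} {v} u≈v = Teich-π-injective _ _ (hat-Teich u) (hat-Teich v) (F.trans (π-hat u) (F.trans u≈v (F.sym (π-hat v))))

  hat-unique : ∀ t u → Teich t → π t F.≈ u → t ≈ hat u
  hat-unique t u Tt πt≈u = Teich-π-injective _ _ Tt (hat-Teich u) (F.trans πt≈u (F.sym (π-hat u)))

  hat-* : ∀ u v → hat (u F.* v) ≈ hat u * hat v
  hat-* u v = R.sym (hat-unique _ _ (Teich-* _ _ (hat-Teich u) (hat-Teich v)) (F.trans (*-homo _ _) (F.*-cong (π-hat u) (π-hat v))))

  hat-pow : ∀ u m → hat (F.pow u m) ≈ pow (hat u) m
  hat-pow u m = R.sym (hat-unique _ _ (Teich-pow _ m (hat-Teich u)) (F.trans (πᴴ.homo-pow _ m) (F.pow-cong m (π-hat u))))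

  hat-0 : hat F.0# ≈ 0#
  hat-0 = R.sym (hat-unique _ _ Teich-0 0#-homo)

  hat-1 : hat F.1# ≈ 1#
  hat-1 = R.sym (hat-unique _ _ Teich-1 1#-homo)

  pow-q≈idᶠ : ∀ u → F.pow u q F.≈ u
  pow-q≈idᶠ u = F.trans (F.sym (F.trans (πᴴ.homo-pow (hat u) q) (F.pow-cong q (π-hat u))))
                        (F.trans (⟦⟧-cong (Teich-pow-q (hat u) (hat-Teich u))) (π-hat u))

  _≟ᶠ_ : Decidable F._≈_
  u ≟ᶠ v with hat u ≈R? hat v
  ... | yes p = yes (F.trans (F.sym (π-hat u)) (F.trans (⟦⟧-cong p) (π-hat v)))
  ... | no p = no (λ u≈v → p (hat-cong u≈v))

  module 𝔽 = CharacteristicTwoField k F isField 1+1≈0ᶠ pow-q≈idᶠ _≟ᶠ_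

  2x≈2·hat[πx] : ∀ x → two * x ≈ two * hat (π x)
  2x≈2·hat[πx] x with πx≈πy⇒x≈y+2z x (hat (π x)) (F.sym (π-hat (π x)))
  ... | z , x≈x̂+2z = begin
    two * x                              ≈⟨ R.*-congˡ x≈x̂+2z ⟩
    two * (hat (π x) + two * z)          ≈⟨ R.distribˡ two _ _ ⟩
    two * hat (π x) + two * (two * z)    ≈⟨ R.+-congˡ (2*[2*x]≈0 z) ⟩
    two * hat (π x) + 0#                 ≈⟨ R.+-identityʳ _ ⟩
    two * hat (π x)                      ∎
    where open SetoidReasoning R.setoid

  2·-cong : ∀ x y → π x F.≈ π y → two * x ≈ two * y
  2·-cong x y πx≈πy = R.trans (2x≈2·hat[πx] x) (R.trans (R.*-congˡ (hat-cong πx≈πy)) (R.sym (2x≈2·hat[πx] y)))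

  2·hat-+ : ∀ u v → two * hat u + two * hat v ≈ two * hat (u F.+ v)
  2·hat-+ u v = R.trans (R.sym (R.distribˡ two _ _))
    (2·-cong _ _ (F.trans (+-homo _ _) (F.trans (F.+-cong (π-hat u) (π-hat v)) (F.sym (π-hat _)))))

  decomposition-unique : ∀ a b a′ b′ → Teich a → Teich b → Teich a′ → Teich b′ →
                         a + two * b ≈ a′ + two * b′ → a ≈ a′ × b ≈ b′
  decomposition-unique a b a′ b′ Ta Tb Ta′ Tb′ eq = a≈a′ , b≈b′
    where
    a≈a′ : a ≈ a′
    a≈a′ = Teich-π-injective a a′ Ta Ta′ (F.trans (F.sym (π[a+2y]≈πa a b)) (F.trans (⟦⟧-cong eq) (π[a+2y]≈πa a′ b′)))
    2[b-b′]≈0 : two * (b + - b′) ≈ 0#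
    2[b-b′]≈0 = R.trans (R.distribˡ two b _) (R.trans (R.+-congʳ 2b≈2b′)
      (R.trans (R.sym (R.distribˡ two b′ _)) (R.trans (R.*-congˡ (R.-‿inverseʳ b′)) (R.zeroʳ two))))
      where
      2b≈2b′ : two * b ≈ two * b′
      2b≈2b′ = R.+-cancelˡ a _ _ (R.trans eq (R.+-congʳ (R.sym a≈a′)))
    b≈b′ : b ≈ b′
    b≈b′ = Teich-π-injective b b′ Tb Tb′ (F.x∙y⁻¹≈ε⇒x≈y _ _
      (F.trans (F.sym (F.trans (+-homo b (- b′)) (F.+-congˡ (-‿homo b′)))) (2x≈0⇒πx≈0 _ 2[b-b′]≈0)))

  d₀ d₁ : R.Carrier → R.Carrier
  d₀ x = proj₁ (decomp x)
  d₁ x = proj₂ (decomp x)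

  decomposition-of : ∀ x a y → Teich a → x ≈ a + two * y → d₀ x ≈ a × d₁ x ≈ hat (π y)
  decomposition-of x a y Ta x≈a+2y = decomposition-unique _ _ _ _
    (proj₁ (isDecomp x)) (proj₁ (proj₂ (isDecomp x))) Ta (hat-Teich (π y))
    (R.trans (R.sym (proj₂ (proj₂ (isDecomp x)))) (R.trans x≈a+2y (R.+-congˡ (2x≈2·hat[πx] y))))

  -- s = √t, s′ = √t′ ∈ T and (s + s′)² = t + t′ + 2 s s′; the Teichmüller part c of s + s′ satisfies c² ≡ (s + s′)² mod 4.
  Teich-sum : ∀ t t′ → Teich t → Teich t′ → t + t′ ≈ hat (π t F.+ π t′) + two * hat (𝔽.√ (π t F.* π t′))
  Teich-sum t t′ Tt Tt′ = begin
    t + t′                             ≈⟨ R.+-cancelʳ (two * (s * s′)) _ _ t+t′+2ss′≈c²+4ss′ ⟩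
    c * c + two * (s * s′)             ≈⟨ R.+-cong c²≈hat (2·-cong _ _ πss′≈) ⟩
    hat (π t F.+ π t′) + two * hat (𝔽.√ (π t F.* π t′)) ∎
    where
    open SetoidReasoning R.setoid
    s = pow t h
    s′ = pow t′ h
    c = d₀ (s + s′)
    s+s′≈c+2e : s + s′ ≈ c + two * d₁ (s + s′)
    s+s′≈c+2e = proj₂ (proj₂ (isDecomp (s + s′)))
    t+t′+2ss′≈c²+4ss′ : t + t′ + two * (s * s′) ≈ c * c + two * (s * s′) + two * (s * s′)
    t+t′+2ss′≈c²+4ss′ = begin
      t + t′ + two * (s * s′)                           ≈⟨ R.+-congʳ (R.+-cong (Teich-square-root t Tt) (Teich-square-root t′ Tt′)) ⟨
      s * s + s′ * s′ + two * (s * s′)                  ≈⟨ R.solve 2 (λ s s′ → s :* s :+ s′ :* s′ :+ con 2 :* (s :* s′) := (s :+ s′) :* (s :+ s′)) R.refl s s′ ⟩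
      (s + s′) * (s + s′)                               ≈⟨ R.trans (R.*-cong s+s′≈c+2e s+s′≈c+2e) ([c+2z]²≈c² c _) ⟩
      c * c                                             ≈⟨ R.+-identityʳ _ ⟨
      c * c + 0#                                        ≈⟨ R.+-congˡ (2x+2x≈0 _) ⟨
      c * c + (two * (s * s′) + two * (s * s′))         ≈⟨ R.+-assoc _ _ _ ⟨
      c * c + two * (s * s′) + two * (s * s′)           ∎
      where open R using (con; _:*_; _:+_; _:=_)
    πc≈πs+πs′ : π c F.≈ π s F.+ π s′
    πc≈πs+πs′ = F.trans (F.sym (π[a+2y]≈πa c _)) (F.trans (⟦⟧-cong (R.sym s+s′≈c+2e)) (+-homo s s′))
    π[r^h]² : ∀ r → Teich r → π (pow r h) F.* π (pow r h) F.≈ π r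
    π[r^h]² r Tr = F.trans (F.sym (*-homo _ _)) (⟦⟧-cong (Teich-square-root r Tr))
    c²≈hat : c * c ≈ hat (π t F.+ π t′)
    c²≈hat = hat-unique _ _ (Teich-* _ _ (proj₁ (isDecomp (s + s′))) (proj₁ (isDecomp (s + s′))))
      (F.trans (*-homo c c) (F.trans (F.*-cong πc≈πs+πs′ πc≈πs+πs′)
        (F.trans (𝔽.square-+ _ _) (F.+-cong (π[r^h]² t Tt) (π[r^h]² t′ Tt′)))))
    πss′≈ : π (s * s′) F.≈ π (hat (𝔽.√ (π t F.* π t′)))
    πss′≈ = F.trans (*-homo s s′) (F.trans (F.*-cong (πᴴ.homo-pow t h) (πᴴ.homo-pow t′ h))
      (F.trans (F.sym (F.pow-distrib-* (π t) (π t′) h)) (F.sym (π-hat _))))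

  -- The Frobenius lift and the trace

  Φ : ℕ → R.Carrier → R.Carrier
  Φ m x = pow (d₀ x) (2 ℕ.^ m) + two * pow (d₁ x) (2 ℕ.^ m)

  Φ-of : ∀ m x a y → Teich a → x ≈ a + two * y → Φ m x ≈ pow a (2 ℕ.^ m) + two * pow y (2 ℕ.^ m)
  Φ-of m x a y Ta x≈a+2y = R.+-cong (R.pow-cong N (proj₁ d))
    (R.trans (R.*-congˡ (R.pow-cong N (proj₂ d))) (2·-cong _ _
      (F.trans (πᴴ.homo-pow _ N) (F.trans (F.pow-cong N (π-hat (π y))) (F.sym (πᴴ.homo-pow y N))))))
    where
    N = 2 ℕ.^ m
    d = decomposition-of x a y Ta x≈a+2y

  Φ-cong : ∀ m {x x′} → x ≈ x′ → Φ m x ≈ Φ m x′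
  Φ-cong m {x} {x′} x≈x′ = Φ-of m x (d₀ x′) (d₁ x′) (proj₁ (isDecomp x′)) (R.trans x≈x′ (proj₂ (proj₂ (isDecomp x′))))

  0^2^m≈0 : ∀ m → pow 0# (2 ℕ.^ m) ≈ 0#
  0^2^m≈0 zero = R.zeroˡ _
  0^2^m≈0 (suc m) = R.trans (R.pow-2^-suc 0# m) (R.trans (R.*-congʳ (0^2^m≈0 m)) (R.zeroˡ _))

  Φ-0 : ∀ m → Φ m 0# ≈ 0#
  Φ-0 m = R.trans (Φ-of m 0# 0# 0# Teich-0 (R.sym (R.trans (R.+-congˡ (R.zeroʳ two)) (R.+-identityʳ 0#))))
    (R.trans (R.+-cong (0^2^m≈0 m) (R.trans (R.*-congˡ (0^2^m≈0 m)) (R.zeroʳ two))) (R.+-identityʳ 0#))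

  -- Φ m is additive: with a + a′ = c + 2 d (Teich-sum), the Teichmüller part of Φ m (x + x′) is c^(2^m),
  -- and c^(2^m) + 2 d^(2^m) = a^(2^m) + a′^(2^m) by Teich-sum applied to the 2^m-th powers.
  module FrobeniusLiftSum (m : ℕ) (x x′ : R.Carrier) where
    N = 2 ℕ.^ m
    a = d₀ x
    b = d₁ x
    a′ = d₀ x′
    b′ = d₁ x′
    Ta = proj₁ (isDecomp x)
    Ta′ = proj₁ (isDecomp x′)
    c = hat (π a F.+ π a′)
    d = hat (𝔽.√ (π a F.* π a′))

    x+x′≈c+2e : x + x′ ≈ c + two * (d + (b + b′))
    x+x′≈c+2e = begin
      x + x′                              ≈⟨ R.+-cong (proj₂ (proj₂ (isDecomp x))) (proj₂ (proj₂ (isDecomp x′))) ⟩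
      (a + two * b) + (a′ + two * b′)     ≈⟨ R.solve 4 (λ a b a′ b′ → (a :+ con 2 :* b) :+ (a′ :+ con 2 :* b′)
                                                := (a :+ a′) :+ con 2 :* (b :+ b′)) R.refl a b a′ b′ ⟩
      (a + a′) + two * (b + b′)           ≈⟨ R.+-congʳ (Teich-sum a a′ Ta Ta′) ⟩
      (c + two * d) + two * (b + b′)      ≈⟨ R.solve 3 (λ c d e → (c :+ con 2 :* d) :+ con 2 :* e := c :+ con 2 :* (d :+ e)) R.refl c d (b + b′) ⟩
      c + two * (d + (b + b′))            ∎
      where
      open SetoidReasoning R.setoid
      open R using (con; _:*_; _:+_; _:=_)

    2[d+b+b′]^N≈ : two * pow (d + (b + b′)) N ≈ two * pow d N + (two * pow b N + two * pow b′ N)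
    2[d+b+b′]^N≈ = R.trans (2·-cong _ _ π≈) (R.trans (R.distribˡ two _ _) (R.+-congˡ (R.distribˡ two _ _)))
      where
      π≈ : π (pow (d + (b + b′)) N) F.≈ π (pow d N + (pow b N + pow b′ N))
      π≈ = F.trans (πᴴ.homo-pow _ N) (F.trans (F.pow-cong N (F.trans (+-homo _ _) (F.+-congˡ (+-homo _ _))))
        (F.trans (𝔽.pow-2^-+ m _ _) (F.trans (F.+-congˡ (𝔽.pow-2^-+ m _ _))
        (F.sym (F.trans (+-homo _ _) (F.+-cong (πᴴ.homo-pow d N) (F.trans (+-homo _ _) (F.+-cong (πᴴ.homo-pow b N) (πᴴ.homo-pow b′ N)))))))))

    c^N+2d^N≈a^N+a′^N : pow c N + two * pow d N ≈ pow a N + pow a′ N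
    c^N+2d^N≈a^N+a′^N = R.sym (R.trans (Teich-sum t t′ (Teich-pow a N Ta) (Teich-pow a′ N Ta′)) (R.+-cong hat≈c^N (2·-cong _ _ π√≈πd^N)))
      where
      t = pow a N
      t′ = pow a′ N
      πt : π t F.≈ F.pow (π a) N
      πt = πᴴ.homo-pow a N
      πt′ : π t′ F.≈ F.pow (π a′) N
      πt′ = πᴴ.homo-pow a′ N
      hat≈c^N : hat (π t F.+ π t′) ≈ pow c N
      hat≈c^N = R.trans (hat-cong (F.trans (F.+-cong πt πt′) (F.sym (𝔽.pow-2^-+ m _ _)))) (hat-pow _ N)
      π√≈πd^N : π (hat (𝔽.√ (π t F.* π t′))) F.≈ π (pow d N)
      π√≈πd^N = F.trans (π-hat _) (F.trans (F.pow-cong h (F.*-cong πt πt′))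
        (F.trans (F.pow-cong h (F.sym (F.pow-distrib-* (π a) (π a′) N)))
        (F.trans (F.pow-pow-comm _ N h) (F.sym (F.trans (πᴴ.homo-pow d N) (F.pow-cong N (π-hat _)))))))

    Φ-+ : Φ m (x + x′) ≈ Φ m x + Φ m x′
    Φ-+ = begin
      Φ m (x + x′)                                                   ≈⟨ Φ-of m _ c (d + (b + b′)) (hat-Teich _) x+x′≈c+2e ⟩
      pow c N + two * pow (d + (b + b′)) N                           ≈⟨ R.+-congˡ 2[d+b+b′]^N≈ ⟩
      pow c N + (two * pow d N + (two * pow b N + two * pow b′ N))   ≈⟨ R.+-assoc _ _ _ ⟨
      (pow c N + two * pow d N) + (two * pow b N + two * pow b′ N)   ≈⟨ R.+-congʳ c^N+2d^N≈a^N+a′^N ⟩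
      (pow a N + pow a′ N) + (two * pow b N + two * pow b′ N)        ≈⟨ R.solve 4 (λ a a′ b b′ → (a :+ a′) :+ (b :+ b′)
                                                                          := (a :+ b) :+ (a′ :+ b′)) R.refl _ _ _ _ ⟩
      Φ m x + Φ m x′                                                 ∎
      where
      open SetoidReasoning R.setoid
      open R using (con; _:*_; _:+_; _:=_)

  Φ-+ : ∀ m x x′ → Φ m (x + x′) ≈ Φ m x + Φ m x′
  Φ-+ m x x′ = FrobeniusLiftSum.Φ-+ m x x′

  Tr-cong : ∀ {x y} → x ≈ y → C.Tr x ≈ C.Tr y
  Tr-cong x≈y = R.sumR-cong n (λ i → Φ-cong i x≈y)

  Tr-+ : ∀ x y → C.Tr (x + y) ≈ C.Tr x + C.Tr y
  Tr-+ x y = R.trans (R.sumR-cong n (λ i → Φ-+ i x y)) (R.sumR-+ n _ _)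

  Φ₁∘Φ : ∀ m x → Φ 1 (Φ m x) ≈ Φ (suc m) x
  Φ₁∘Φ m x = R.trans (Φ-of 1 (Φ m x) (pow a N) (pow b N) (Teich-pow a N (proj₁ (isDecomp x))) R.refl)
    (R.+-cong (R.trans (R.*-congˡ (R.*-identityʳ _)) (R.sym (R.pow-2^-suc a m)))
              (R.*-congˡ (R.trans (R.*-congˡ (R.*-identityʳ _)) (R.sym (R.pow-2^-suc b m)))))
    where
    N = 2 ℕ.^ m
    a = d₀ x
    b = d₁ x

  Φ₁-sumR : ∀ j f → Φ 1 (R.sumR j f) ≈ R.sumR j (λ i → Φ 1 (f i))
  Φ₁-sumR zero f = Φ-0 1
  Φ₁-sumR (suc j) f = R.trans (Φ-+ 1 _ _) (R.+-congʳ (Φ₁-sumR j f))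

  Φₙ≈Φ₀ : ∀ x → Φ n x ≈ Φ 0 x
  Φₙ≈Φ₀ x = R.+-cong (R.trans (Teich-pow-q _ (proj₁ (isDecomp x))) (R.sym (R.*-identityʳ _)))
                     (R.*-congˡ (R.trans (Teich-pow-q _ (proj₁ (proj₂ (isDecomp x)))) (R.sym (R.*-identityʳ _))))

  Φ₁-Tr : ∀ x → Φ 1 (C.Tr x) ≈ C.Tr x
  Φ₁-Tr x = R.+-cancelʳ (Φ 0 x) _ _ (begin
    Φ 1 (C.Tr x) + Φ 0 x                    ≈⟨ R.+-congʳ (R.trans (Φ₁-sumR n (λ i → Φ i x)) (R.sumR-cong n (λ i → Φ₁∘Φ i x))) ⟩
    R.sumR n (λ i → Φ (suc i) x) + Φ 0 x    ≈⟨ R.sumR-shift n (λ i → Φ i x) ⟩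
    R.sumR n (λ i → Φ i x) + Φ n x          ≈⟨ R.+-congˡ (Φₙ≈Φ₀ x) ⟩
    C.Tr x + Φ 0 x                          ∎)
    where open SetoidReasoning R.setoid

  ι : Fin 4 → R.Carrier
  ι zero = 0#
  ι (suc zero) = 1#
  ι (suc (suc zero)) = two
  ι (suc (suc (suc zero))) = R.three

  Tr∈ℤ₄ : ∀ x → Σ (Fin 4) (λ j → C.Tr x ≈ ι j)
  Tr∈ℤ₄ x = from-digits (Teich-idempotent a Ta (proj₁ a²≈a×b²≈b)) (Teich-idempotent b Tb (proj₂ a²≈a×b²≈b))
    where
    z = C.Tr x
    a = d₀ z
    b = d₁ z
    Ta = proj₁ (isDecomp z)
    Tb = proj₁ (proj₂ (isDecomp z))
    z≈a+2b : z ≈ a + two * b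
    z≈a+2b = proj₂ (proj₂ (isDecomp z))
    a²≈a×b²≈b : pow a 2 ≈ a × pow b 2 ≈ b
    a²≈a×b²≈b = decomposition-unique _ _ _ _ (Teich-pow a 2 Ta) (Teich-pow b 2 Tb) Ta Tb (R.trans (Φ₁-Tr x) z≈a+2b)
    from-digits : (a ≈ 0#) ⊎ (a ≈ 1#) → (b ≈ 0#) ⊎ (b ≈ 1#) → Σ (Fin 4) (λ j → z ≈ ι j)
    from-digits (inj₁ a≈0) (inj₁ b≈0) = zero ,
      R.trans z≈a+2b (R.trans (R.+-cong a≈0 (R.trans (R.*-congˡ b≈0) (R.zeroʳ two))) (R.+-identityˡ 0#))
    from-digits (inj₂ a≈1) (inj₁ b≈0) = suc zero ,
      R.trans z≈a+2b (R.trans (R.+-cong a≈1 (R.trans (R.*-congˡ b≈0) (R.zeroʳ two))) (R.+-identityʳ 1#))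
    from-digits (inj₁ a≈0) (inj₂ b≈1) = suc (suc zero) ,
      R.trans z≈a+2b (R.trans (R.+-cong a≈0 (R.trans (R.*-congˡ b≈1) (R.*-identityʳ two))) (R.+-identityˡ two))
    from-digits (inj₂ a≈1) (inj₂ b≈1) = suc (suc (suc zero)) ,
      R.trans z≈a+2b (R.trans (R.+-cong a≈1 (R.trans (R.*-congˡ b≈1) (R.*-identityʳ two))) (R.+-comm 1# two))

  private
    3≉0 : ¬ (R.three ≈ 0#)
    3≉0 3≈0 = 1≉0 (begin
      1#                        ≈⟨ R.+-identityʳ 1# ⟨
      1# + 0#                   ≈⟨ R.+-congˡ (R.trans (R.*-congʳ 2+2≈0) (R.zeroˡ two)) ⟨
      1# + (two + two) * two    ≈⟨ R.solve 0 (con 1 :+ (con 2 :+ con 2) :* con 2 := (con 2 :+ con 1) :* (con 2 :+ con 1)) R.refl ⟩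
      R.three * R.three         ≈⟨ R.*-congʳ 3≈0 ⟩
      0# * R.three              ≈⟨ R.zeroˡ _ ⟩
      0#                        ∎)
      where
      open SetoidReasoning R.setoid
      open R using (con; _:*_; _:+_; _:=_)

    2≉1 : ¬ (two ≈ 1#)
    2≉1 2≈1 = 1≉0 (R.+-cancelˡ 1# _ _ (R.trans 2≈1 (R.sym (R.+-identityʳ 1#))))

    3≉1 : ¬ (R.three ≈ 1#)
    3≉1 3≈1 = 2≉0 (R.+-cancelʳ 1# _ _ (R.trans 3≈1 (R.sym (R.+-identityˡ 1#))))

    3≉2 : ¬ (R.three ≈ two)
    3≉2 3≈2 = 1≉0 (R.+-cancelˡ two _ _ (R.trans 3≈2 (R.sym (R.+-identityʳ two))))

  ι-injective : ∀ i j → ι i ≈ ι j → i ≡ j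
  ι-injective zero zero _ = P.refl
  ι-injective zero (suc zero) e = ⊥-elim (1≉0 (R.sym e))
  ι-injective zero (suc (suc zero)) e = ⊥-elim (2≉0 (R.sym e))
  ι-injective zero (suc (suc (suc zero))) e = ⊥-elim (3≉0 (R.sym e))
  ι-injective (suc zero) zero e = ⊥-elim (1≉0 e)
  ι-injective (suc zero) (suc zero) _ = P.refl
  ι-injective (suc zero) (suc (suc zero)) e = ⊥-elim (2≉1 (R.sym e))
  ι-injective (suc zero) (suc (suc (suc zero))) e = ⊥-elim (3≉1 (R.sym e))
  ι-injective (suc (suc zero)) zero e = ⊥-elim (2≉0 e)
  ι-injective (suc (suc zero)) (suc zero) e = ⊥-elim (2≉1 e)
  ι-injective (suc (suc zero)) (suc (suc zero)) _ = P.refl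
  ι-injective (suc (suc zero)) (suc (suc (suc zero))) e = ⊥-elim (3≉2 (R.sym e))
  ι-injective (suc (suc (suc zero))) zero e = ⊥-elim (3≉0 e)
  ι-injective (suc (suc (suc zero))) (suc zero) e = ⊥-elim (3≉1 e)
  ι-injective (suc (suc (suc zero))) (suc (suc zero)) e = ⊥-elim (3≉2 e)
  ι-injective (suc (suc (suc zero))) (suc (suc (suc zero))) _ = P.refl

  toℤ₄-ι : ∀ x j → x ≈ ι j → C.toℤ₄ x ≡ j
  toℤ₄-ι x j x≈ιj with x ≈R? 0#
  ... | yes x≈0 = ι-injective zero j (R.trans (R.sym x≈0) x≈ιj)
  ... | no x≉0 with x ≈R? 1#
  ... | yes x≈1 = ι-injective (suc zero) j (R.trans (R.sym x≈1) x≈ιj)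
  ... | no x≉1 with x ≈R? two
  ... | yes x≈2 = ι-injective (suc (suc zero)) j (R.trans (R.sym x≈2) x≈ιj)
  ... | no x≉2 with j
  ... | zero = ⊥-elim (x≉0 x≈ιj)
  ... | suc zero = ⊥-elim (x≉1 x≈ιj)
  ... | suc (suc zero) = ⊥-elim (x≉2 x≈ιj)
  ... | suc (suc (suc zero)) = P.refl

  2+2+r≈r : ∀ r → (two + two) + r ≈ r
  2+2+r≈r r = R.trans (R.+-congʳ 2+2≈0) (R.+-identityˡ r)

  ι-+ : ∀ i j → ι i + ι j ≈ ι (i +₄ j)
  ι-+ zero j = R.+-identityˡ _
  ι-+ (suc zero) zero = R.+-identityʳ _
  ι-+ (suc zero) (suc zero) = R.refl
  ι-+ (suc zero) (suc (suc zero)) = R.+-comm 1# two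
  ι-+ (suc zero) (suc (suc (suc zero))) = R.trans (R.solve 0 (con 1 :+ (con 2 :+ con 1) := (con 2 :+ con 2) :+ con 0) R.refl) (2+2+r≈r 0#)
    where open R using (con; _:+_; _:=_)
  ι-+ (suc (suc zero)) zero = R.+-identityʳ _
  ι-+ (suc (suc zero)) (suc zero) = R.refl
  ι-+ (suc (suc zero)) (suc (suc zero)) = 2+2≈0
  ι-+ (suc (suc zero)) (suc (suc (suc zero))) = R.trans (R.solve 0 (con 2 :+ (con 2 :+ con 1) := (con 2 :+ con 2) :+ con 1) R.refl) (2+2+r≈r 1#)
    where open R using (con; _:+_; _:=_)
  ι-+ (suc (suc (suc zero))) zero = R.+-identityʳ _
  ι-+ (suc (suc (suc zero))) (suc zero) = R.trans (R.solve 0 ((con 2 :+ con 1) :+ con 1 := (con 2 :+ con 2) :+ con 0) R.refl) (2+2+r≈r 0#)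
    where open R using (con; _:+_; _:=_)
  ι-+ (suc (suc (suc zero))) (suc (suc zero)) = R.trans (R.solve 0 ((con 2 :+ con 1) :+ con 2 := (con 2 :+ con 2) :+ con 1) R.refl) (2+2+r≈r 1#)
    where open R using (con; _:+_; _:=_)
  ι-+ (suc (suc (suc zero))) (suc (suc (suc zero))) = R.trans (R.solve 0 ((con 2 :+ con 1) :+ (con 2 :+ con 1) := (con 2 :+ con 2) :+ con 2) R.refl) (2+2+r≈r two)
    where open R using (con; _:+_; _:=_)

  -- Additive characters

  ψ : R.Carrier → ℚi
  ψ x = C.ωpow (C.toℤ₄ (C.Tr x))

  ψ-ι : ∀ x j → C.Tr x ≈ ι j → ψ x ≡ ωpow j
  ψ-ι x j Trx≈ιj = cong ωpow (toℤ₄-ι _ j Trx≈ιj)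

  ψ-cong : ∀ {x y} → x ≈ y → ψ x ≡ ψ y
  ψ-cong {x} {y} x≈y = P.trans (ψ-ι x j (proj₂ (Tr∈ℤ₄ x))) (P.sym (ψ-ι y j (R.trans (Tr-cong (R.sym x≈y)) (proj₂ (Tr∈ℤ₄ x)))))
    where j = proj₁ (Tr∈ℤ₄ x)

  ψ-+ : ∀ x y → ψ (x + y) ≡ ψ x ⊗ ψ y
  ψ-+ x y = begin
    ψ (x + y)             ≡⟨ ψ-ι (x + y) (i +₄ j) (R.trans (Tr-+ x y) (R.trans (R.+-cong (proj₂ (Tr∈ℤ₄ x)) (proj₂ (Tr∈ℤ₄ y))) (ι-+ i j))) ⟩
    ωpow (i +₄ j)         ≡⟨ ωpow-homo i j ⟩
    ωpow i ⊗ ωpow j       ≡⟨ cong₂ _⊗_ (ψ-ι x i (proj₂ (Tr∈ℤ₄ x))) (ψ-ι y j (proj₂ (Tr∈ℤ₄ y))) ⟨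
    ψ x ⊗ ψ y             ∎
    where
    open P.≡-Reasoning
    i = proj₁ (Tr∈ℤ₄ x)
    j = proj₁ (Tr∈ℤ₄ y)

  ψ-0 : ψ 0# ≡ 1i
  ψ-0 = ψ-ι 0# zero (R.+-cancelˡ (C.Tr 0#) _ _
    (R.trans (R.sym (Tr-+ 0# 0#)) (R.trans (Tr-cong (R.+-identityʳ 0#)) (R.sym (R.+-identityʳ _)))))

  conj-ψ⊗ψ≡1 : ∀ x → conj (ψ x) ⊗ ψ x ≡ 1i
  conj-ψ⊗ψ≡1 x = conj-ω^⊗ω^≡1 (toℕ (C.toℤ₄ (C.Tr x)))

  normSq-ψ : ∀ x → normSq (ψ x) ≡ 1ℚ
  normSq-ψ x = normSq-ω^ (toℕ (C.toℤ₄ (C.Tr x)))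

  Tr-2 : C.Tr two ≈ two
  Tr-2 = begin
    C.Tr two                   ≈⟨ R.sumR-cong n Φ-2 ⟩
    R.sumR n (λ _ → two)       ≈⟨ R.sumR-const n two ⟩
    n R.×ₙ two                 ≡⟨ cong (R._×ₙ two) n≡1+[k+k] ⟩
    suc (k ℕ.+ k) R.×ₙ two     ≈⟨ R.[1+2j]×ₙx≈x two 2+2≈0 k ⟩
    two                        ∎
    where
    open SetoidReasoning R.setoid
    Φ-2 : ∀ i → Φ i two ≈ two
    Φ-2 i = R.trans (Φ-of i two 0# 1# Teich-0 (R.sym (R.trans (R.+-identityˡ _) (R.*-identityʳ two))))
      (R.trans (R.+-cong (0^2^m≈0 i) (R.*-congˡ (R.pow-1# (2 ℕ.^ i)))) (R.trans (R.+-identityˡ _) (R.*-identityʳ two)))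

  ψ-2 : ψ two ≡ -1i
  ψ-2 = P.trans (ψ-ι two (suc (suc zero)) Tr-2) ωpow-2≡-1

  ε : F.Carrier → ℚi
  ε u = ψ (two * hat u)

  χ : F.Carrier → ℚi
  χ u = ψ (hat u)

  ε-cong : ∀ {u v} → u F.≈ v → ε u ≡ ε v
  ε-cong u≈v = ψ-cong (R.*-congˡ (hat-cong u≈v))

  χ-cong : ∀ {u v} → u F.≈ v → χ u ≡ χ v
  χ-cong u≈v = ψ-cong (hat-cong u≈v)

  ε-+ : ∀ u v → ε (u F.+ v) ≡ ε u ⊗ ε v
  ε-+ u v = P.trans (ψ-cong (R.sym (2·hat-+ u v))) (ψ-+ (two * hat u) (two * hat v))

  ε-0 : ∀ {u} → u F.≈ F.0# → ε u ≡ 1i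
  ε-0 u≈0 = P.trans (ψ-cong (R.trans (R.*-congˡ (R.trans (hat-cong u≈0) hat-0)) (R.zeroʳ two))) ψ-0

  χ-0 : ∀ {u} → u F.≈ F.0# → χ u ≡ 1i
  χ-0 u≈0 = P.trans (ψ-cong (R.trans (hat-cong u≈0) hat-0)) ψ-0

  ε-1 : ε F.1# ≡ -1i
  ε-1 = P.trans (ψ-cong (R.trans (R.*-congˡ hat-1) (R.*-identityʳ two))) ψ-2

  ε⊗ε≡1 : ∀ u → ε u ⊗ ε u ≡ 1i
  ε⊗ε≡1 u = P.trans (P.sym (ε-+ u u)) (ε-0 (𝔽.x+x≈0 u))

  conj-ε : ∀ u → conj (ε u) ≡ ε u
  conj-ε u = begin
    conj (ε u)                     ≡⟨ ⊗-identityʳ (conj (ε u)) ⟨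
    conj (ε u) ⊗ 1i                ≡⟨ cong (conj (ε u) ⊗_) (ε⊗ε≡1 u) ⟨
    conj (ε u) ⊗ (ε u ⊗ ε u)       ≡⟨ ⊗-assoc (conj (ε u)) (ε u) (ε u) ⟨
    (conj (ε u) ⊗ ε u) ⊗ ε u       ≡⟨ cong (_⊗ ε u) (conj-ψ⊗ψ≡1 (two * hat u)) ⟩
    1i ⊗ ε u                       ≡⟨ ⊗-identityˡ (ε u) ⟩
    ε u                            ∎
    where open P.≡-Reasoning

  χ-+ : ∀ u v → χ (u F.+ v) ≡ (χ u ⊗ χ v) ⊗ ε (𝔽.√ (u F.* v))
  χ-+ u v = begin
    χ (u F.+ v)                      ≡⟨ ⊗-identityʳ (χ (u F.+ v)) ⟨
    χ (u F.+ v) ⊗ 1i                 ≡⟨ cong (χ (u F.+ v) ⊗_) (ε⊗ε≡1 w) ⟨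
    χ (u F.+ v) ⊗ (ε w ⊗ ε w)        ≡⟨ ⊗-assoc (χ (u F.+ v)) (ε w) (ε w) ⟨
    (χ (u F.+ v) ⊗ ε w) ⊗ ε w        ≡⟨ cong (_⊗ ε w) (ψ-+ (hat (u F.+ v)) (two * hat w)) ⟨
    ψ (hat (u F.+ v) + two * hat w) ⊗ ε w ≡⟨ cong (_⊗ ε w) (ψ-cong (R.sym û+v̂≈)) ⟩
    ψ (hat u + hat v) ⊗ ε w          ≡⟨ cong (_⊗ ε w) (ψ-+ (hat u) (hat v)) ⟩
    (χ u ⊗ χ v) ⊗ ε w                ∎
    where
    open P.≡-Reasoning
    w = 𝔽.√ (u F.* v)
    û+v̂≈ : hat u + hat v ≈ hat (u F.+ v) + two * hat w
    û+v̂≈ = R.trans (Teich-sum (hat u) (hat v) (hat-Teich u) (hat-Teich v))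
      (R.+-cong (hat-cong (F.+-cong (π-hat u) (π-hat v))) (R.*-congˡ (hat-cong (F.pow-cong h (F.*-cong (π-hat u) (π-hat v))))))

  V : Set
  V = F.Carrier × F.Carrier

  infix 4 _≈V_
  _≈V_ : V → V → Set
  (a , b) ≈V (c , d) = (a F.≈ c) × (b F.≈ d)

  ≈V-sym : ∀ {v w} → v ≈V w → w ≈V v
  ≈V-sym (e₁ , e₂) = F.sym e₁ , F.sym e₂

  ≈V-trans : ∀ {u v w} → u ≈V v → v ≈V w → u ≈V w
  ≈V-trans (e₁ , e₂) (f₁ , f₂) = F.trans e₁ f₁ , F.trans e₂ f₂

  N : ℕ
  N = q ℕ.* q

  index : F.Carrier → Fin q
  index x = proj₁ (proj₂ isEnum x)

  enum-index : ∀ x → enumF (index x) F.≈ x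
  enum-index x = proj₂ (proj₂ isEnum x)

  index-cong : ∀ {x y} → x F.≈ y → index x ≡ index y
  index-cong {x} {y} x≈y = proj₁ isEnum _ _ (F.trans (enum-index x) (F.trans x≈y (F.sym (enum-index y))))

  indexV : V → Fin N
  indexV (a , b) = Fin.combine (index a) (index b)

  indexV-cong : ∀ {v w} → v ≈V w → indexV v ≡ indexV w
  indexV-cong (e₁ , e₂) = cong₂ Fin.combine (index-cong e₁) (index-cong e₂)

  pt : Fin N → V
  pt = C.pt

  pt-indexV : ∀ v → pt (indexV v) ≈V v
  pt-indexV (a , b) = P.subst (λ p → (enumF (proj₁ p) , enumF (proj₂ p)) ≈V (a , b))
    (P.sym (FinP.remQuot-combine {q} {q} (index a) (index b))) (enum-index a , enum-index b)

  indexV-pt : ∀ i → indexV (pt i) ≡ i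
  indexV-pt i = P.trans (cong₂ Fin.combine (index-enum _) (index-enum _)) (FinP.combine-remQuot {q} q i)
    where
    index-enum : ∀ j → index (enumF j) ≡ j
    index-enum j = proj₁ isEnum _ _ (enum-index (enumF j))

  pt-injective : ∀ i j → pt i ≈V pt j → i ≡ j
  pt-injective i j pti≈ptj = P.trans (P.sym (indexV-pt i)) (P.trans (indexV-cong pti≈ptj) (indexV-pt j))

  Respects≈V : (V → ℚi) → Set
  Respects≈V G = ∀ {v w} → v ≈V w → G v ≡ G w

  sum-reindex : (g g′ : V → V) → (∀ {v w} → v ≈V w → g v ≈V g w) → (∀ {v w} → v ≈V w → g′ v ≈V g′ w) →
                (∀ v → g (g′ v) ≈V v) → (∀ v → g′ (g v) ≈V v) → (G : V → ℚi) → Respects≈V G →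
                sum {N} (λ i → G (pt i)) ≡ sum {N} (λ i → G (g (pt i)))
  sum-reindex g g′ g-cong g′-cong gg′≈id g′g≈id G G-resp =
    P.trans (sum-permute (λ i → G (pt i)) σ) (sum-cong-≗ {N} (λ i → G-resp (pt-indexV (g (pt i)))))
    where
    to from : Fin N → Fin N
    to i = indexV (g (pt i))
    from j = indexV (g′ (pt j))
    σ : Perm.Permutation N N
    σ = Perm.permutation to from
      (λ j → P.trans (indexV-cong (≈V-trans (g-cong (pt-indexV (g′ (pt j)))) (gg′≈id (pt j)))) (indexV-pt j))
      (λ i → P.trans (indexV-cong (≈V-trans (g′-cong (pt-indexV (g (pt i)))) (g′g≈id (pt i)))) (indexV-pt i))

  linear : F.Carrier → F.Carrier → V → F.Carrier
  linear l₁ l₂ (v₁ , v₂) = l₁ F.* v₁ F.+ l₂ F.* v₂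

  linear-cong : ∀ l₁ l₂ {v w} → v ≈V w → linear l₁ l₂ v F.≈ linear l₁ l₂ w
  linear-cong l₁ l₂ (e₁ , e₂) = F.+-cong (F.*-congˡ e₁) (F.*-congˡ e₂)

  -- Translating by t with l(t) = 1 multiplies every term by ε 1 = -1.
  sum-ε-linear≡0′ : ∀ l₁ l₂ t₁ t₂ → l₁ F.* t₁ F.+ l₂ F.* t₂ F.≈ F.1# →
                    sum {N} (λ i → ε (linear l₁ l₂ (pt i))) ≡ 0i
  sum-ε-linear≡0′ l₁ l₂ t₁ t₂ l[t]≈1 = ≡⊗-1⇒≡0 _ (P.trans (sum-reindex g g g-cong g-cong gg≈id gg≈id G G-resp)
    (P.trans (sum-cong-≗ {N} (λ i → G∘g (pt i))) (P.sym (*-distribʳ-sum -1i (λ i → G (pt i))))))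
    where
    g : V → V
    g (v₁ , v₂) = (v₁ F.+ t₁) , (v₂ F.+ t₂)
    g-cong : ∀ {v w} → v ≈V w → g v ≈V g w
    g-cong (e₁ , e₂) = F.+-congʳ e₁ , F.+-congʳ e₂
    x+t+t≈x : ∀ x t → (x F.+ t) F.+ t F.≈ x
    x+t+t≈x x t = F.trans (F.+-assoc x t t) (F.trans (F.+-congˡ (𝔽.x+x≈0 t)) (F.+-identityʳ x))
    gg≈id : ∀ v → g (g v) ≈V v
    gg≈id (v₁ , v₂) = x+t+t≈x v₁ t₁ , x+t+t≈x v₂ t₂
    G : V → ℚi
    G v = ε (linear l₁ l₂ v)
    G-resp : Respects≈V G
    G-resp v≈w = ε-cong (linear-cong l₁ l₂ v≈w)
    G∘g : ∀ v → G (g v) ≡ G v ⊗ -1i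
    G∘g (v₁ , v₂) = P.trans (ε-cong l∘g≈l+1) (P.trans (ε-+ _ _) (cong (G (v₁ , v₂) ⊗_) ε-1))
      where
      l∘g≈l+1 : linear l₁ l₂ (g (v₁ , v₂)) F.≈ linear l₁ l₂ (v₁ , v₂) F.+ F.1#
      l∘g≈l+1 = F.trans (F.solve 6 (λ l₁ l₂ v₁ v₂ t₁ t₂ → l₁ :* (v₁ :+ t₁) :+ l₂ :* (v₂ :+ t₂)
                                      := (l₁ :* v₁ :+ l₂ :* v₂) :+ (l₁ :* t₁ :+ l₂ :* t₂)) F.refl l₁ l₂ v₁ v₂ t₁ t₂)
                        (F.+-congˡ l[t]≈1)
        where open F using (_:*_; _:+_; _:=_)

  sum-ε-linear≡0 : ∀ l₁ l₂ → ¬ (l₁ F.≈ F.0# × l₂ F.≈ F.0#) → sum {N} (λ i → ε (linear l₁ l₂ (pt i))) ≡ 0i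
  sum-ε-linear≡0 l₁ l₂ l≉0 with l₁ ≟ᶠ F.0# | l₂ ≟ᶠ F.0#
  ... | no l₁≉0 | _ = sum-ε-linear≡0′ l₁ l₂ (𝔽.inverse l₁ l₁≉0) F.0#
    (F.trans (F.+-cong (𝔽.*-inverseʳ l₁ l₁≉0) (F.zeroʳ l₂)) (F.+-identityʳ _))
  ... | yes _ | no l₂≉0 = sum-ε-linear≡0′ l₁ l₂ F.0# (𝔽.inverse l₂ l₂≉0)
    (F.trans (F.+-cong (F.zeroʳ l₁) (𝔽.*-inverseʳ l₂ l₂≉0)) (F.+-identityˡ _))
  ... | yes l₁≈0 | yes l₂≈0 = ⊥-elim (l≉0 (l₁≈0 , l₂≈0))

  q² : ℚi
  q² = sum {N} (λ _ → 1i)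

  linear-zero : ∀ {l₁ l₂} → l₁ F.≈ F.0# → l₂ F.≈ F.0# → ∀ v → linear l₁ l₂ v F.≈ F.0#
  linear-zero l₁≈0 l₂≈0 (v₁ , v₂) =
    F.trans (F.+-cong (F.trans (F.*-congʳ l₁≈0) (F.zeroˡ _)) (F.trans (F.*-congʳ l₂≈0) (F.zeroˡ _))) (F.+-identityʳ F.0#)

  sum-ε-zero : ∀ l₁ l₂ → l₁ F.≈ F.0# → l₂ F.≈ F.0# → sum {N} (λ i → ε (linear l₁ l₂ (pt i))) ≡ q²
  sum-ε-zero l₁ l₂ l₁≈0 l₂≈0 = sum-cong-≗ {N} (λ i → ε-0 (linear-zero l₁≈0 l₂≈0 (pt i)))

  crossTerm : F.Carrier → F.Carrier → V → V → F.Carrier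
  crossTerm α β (v₁ , v₂) (w₁ , w₂) = 𝔽.offDiag α β F.* (w₁ F.* w₂) F.+ (v₁ F.* w₁ F.+ v₂ F.* w₂)

  exponent-split : ∀ α β v₁ v₂ w₁ w₂ → C.expo α β v₁ v₂ w₁ w₂ ≈
    (hat (α F.* (w₁ F.* w₁)) + hat (β F.* (w₂ F.* w₂))) + two * hat (crossTerm α β (v₁ , v₂) (w₁ , w₂))
  exponent-split α β v₁ v₂ w₁ w₂ = begin
    C.expo α β v₁ v₂ w₁ w₂                  ≈⟨ R.solve 7 (λ a m b x₁ x₂ y₁ y₂ →
        (x₁ :* (x₁ :* a :+ x₂ :* m) :+ x₂ :* (x₁ :* m :+ x₂ :* b)) :+ con 2 :* (y₁ :* x₁ :+ y₂ :* x₂)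
        := (a :* (x₁ :* x₁) :+ b :* (x₂ :* x₂)) :+ con 2 :* (m :* (x₁ :* x₂) :+ (y₁ :* x₁ :+ y₂ :* x₂))) R.refl a m b x₁ x₂ y₁ y₂ ⟩
    (a * (x₁ * x₁) + b * (x₂ * x₂)) + two * (m * (x₁ * x₂) + (y₁ * x₁ + y₂ * x₂))
                                            ≈⟨ R.+-cong (R.+-cong (hat-*² α w₁) (hat-*² β w₂)) (2·-cong _ _ π≈) ⟩
    (hat (α F.* (w₁ F.* w₁)) + hat (β F.* (w₂ F.* w₂))) + two * hat (crossTerm α β (v₁ , v₂) (w₁ , w₂)) ∎
    where
    open SetoidReasoning R.setoid
    open R using (con; _:*_; _:+_; _:=_)
    a = hat α
    m = hat (𝔽.offDiag α β)
    b = hat β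
    x₁ = hat w₁
    x₂ = hat w₂
    y₁ = hat v₁
    y₂ = hat v₂
    hat-*² : ∀ u w → hat u * (hat w * hat w) ≈ hat (u F.* (w F.* w))
    hat-*² u w = R.sym (R.trans (hat-* u (w F.* w)) (R.*-congˡ (hat-* w w)))
    π-* : ∀ u w → π (hat u * hat w) F.≈ u F.* w
    π-* u w = F.trans (*-homo _ _) (F.*-cong (π-hat u) (π-hat w))
    π≈ : π (m * (x₁ * x₂) + (y₁ * x₁ + y₂ * x₂)) F.≈ π (hat (crossTerm α β (v₁ , v₂) (w₁ , w₂)))
    π≈ = F.trans (+-homo _ _) (F.trans (F.+-cong (F.trans (*-homo _ _) (F.*-cong (π-hat _) (π-* w₁ w₂)))
           (F.trans (+-homo _ _) (F.+-cong (π-* v₁ w₁) (π-* v₂ w₂)))) (F.sym (π-hat _)))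

  phase : V → V → V → ℚi
  phase (α , β) (v₁ , v₂) (w₁ , w₂) = ψ (C.expo α β v₁ v₂ w₁ w₂)

  diagonalPhase : V → V → ℚi
  diagonalPhase (α , β) (w₁ , w₂) = χ (α F.* (w₁ F.* w₁)) ⊗ χ (β F.* (w₂ F.* w₂))

  phase≡ : ∀ c v w → phase c v w ≡ diagonalPhase c w ⊗ ε (crossTerm (proj₁ c) (proj₂ c) v w)
  phase≡ (α , β) (v₁ , v₂) (w₁ , w₂) = P.trans (ψ-cong (exponent-split α β v₁ v₂ w₁ w₂))
    (P.trans (ψ-+ _ (two * hat (crossTerm α β (v₁ , v₂) (w₁ , w₂))))
      (cong (_⊗ ε (crossTerm α β (v₁ , v₂) (w₁ , w₂))) (ψ-+ (hat (α F.* (w₁ F.* w₁))) (hat (β F.* (w₂ F.* w₂))))))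

  phase-resp : ∀ c v → Respects≈V (phase c v)
  phase-resp (α , β) v {w₁ , w₂} {w₁′ , w₂′} (e₁ , e₂) =
    P.trans (phase≡ (α , β) v (w₁ , w₂)) (P.trans (cong₂ _⊗_
      (cong₂ _⊗_ (χ-cong (F.*-congˡ (F.*-cong e₁ e₁))) (χ-cong (F.*-congˡ (F.*-cong e₂ e₂))))
      (ε-cong (F.+-cong (F.*-congˡ (F.*-cong e₁ e₂)) (F.+-cong (F.*-congˡ e₁) (F.*-congˡ e₂)))))
      (P.sym (phase≡ (α , β) v (w₁′ , w₂′))))

  _+V_ : V → V → V
  (a , b) +V (c , d) = (a F.+ c) , (b F.+ d)

  0V : V
  0V = F.0# , F.0#

  phase-0 : ∀ c v → phase c v 0V ≡ 1i
  phase-0 (α , β) (v₁ , v₂) = P.trans (phase≡ (α , β) (v₁ , v₂) 0V)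
    (cong₂ _⊗_ (cong₂ _⊗_ (χ-0 (u*0*0≈0 α)) (χ-0 (u*0*0≈0 β))) (ε-0 cross≈0))
    where
    u*0*0≈0 : ∀ u → u F.* (F.0# F.* F.0#) F.≈ F.0#
    u*0*0≈0 u = F.trans (F.*-congˡ (F.zeroˡ F.0#)) (F.zeroʳ u)
    cross≈0 : crossTerm α β (v₁ , v₂) 0V F.≈ F.0#
    cross≈0 = F.trans (F.+-cong (u*0*0≈0 _) (F.+-cong (F.zeroʳ v₁) (F.zeroʳ v₂)))
                      (F.trans (F.+-congˡ (F.+-identityʳ F.0#)) (F.+-identityʳ F.0#))

  χ-+-square : ∀ a z y → χ (a F.* ((z F.+ y) F.* (z F.+ y))) ≡
               (χ (a F.* (z F.* z)) ⊗ χ (a F.* (y F.* y))) ⊗ ε (a F.* (z F.* y))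
  χ-+-square a z y = P.trans (χ-cong a[z+y]²≈)
    (P.trans (χ-+ _ _) (cong ((χ (a F.* (z F.* z)) ⊗ χ (a F.* (y F.* y))) ⊗_) (ε-cong √≈)))
    where
    open F using (_:*_; _:=_)
    a[z+y]²≈ : a F.* ((z F.+ y) F.* (z F.+ y)) F.≈ a F.* (z F.* z) F.+ a F.* (y F.* y)
    a[z+y]²≈ = F.trans (F.*-congˡ (𝔽.square-+ z y)) (F.distribˡ a _ _)
    √≈ : 𝔽.√ ((a F.* (z F.* z)) F.* (a F.* (y F.* y))) F.≈ a F.* (z F.* y)
    √≈ = F.trans (F.pow-cong h (F.solve 3 (λ a z y → (a :* (z :* z)) :* (a :* (y :* y))
                                            := (a :* (z :* y)) :* (a :* (z :* y))) F.refl a z y))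
                 (𝔽.√-of-square _)

  -- the symmetric bilinear form of the quadratic form w ↦ w M_c wᵀ
  polar : V → V → V → F.Carrier
  polar (α , β) (z₁ , z₂) (y₁ , y₂) =
    α F.* (z₁ F.* y₁) F.+ β F.* (z₂ F.* y₂) F.+ 𝔽.offDiag α β F.* (z₁ F.* y₂ F.+ y₁ F.* z₂)

  phase-+ : ∀ c v z y → phase c v (z +V y) ≡ (phase c v z ⊗ phase c v y) ⊗ ε (polar c z y)
  phase-+ (α , β) v@(v₁ , v₂) z@(z₁ , z₂) y@(y₁ , y₂) = begin
    phase c v (z +V y)
      ≡⟨ phase≡ c v (z +V y) ⟩
    (χ (α F.* ((z₁ F.+ y₁) F.* (z₁ F.+ y₁))) ⊗ χ (β F.* ((z₂ F.+ y₂) F.* (z₂ F.+ y₂)))) ⊗ ε (crossTerm α β v (z +V y))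
      ≡⟨ cong₂ _⊗_ (cong₂ _⊗_ (χ-+-square α z₁ y₁) (χ-+-square β z₂ y₂))
                   (P.trans (ε-cong cross≈) (P.trans (ε-+ _ _) (cong (_⊗ E₃) (ε-+ (crossTerm α β v z) (crossTerm α β v y))))) ⟩
    (((A ⊗ A′) ⊗ E₁) ⊗ ((B ⊗ B′) ⊗ E₂)) ⊗ ((Lz ⊗ Ly) ⊗ E₃)
      ≡⟨ solve 9 (λ A A′ E₁ B B′ E₂ Lz Ly E₃ → (((A :* A′) :* E₁) :* ((B :* B′) :* E₂)) :* ((Lz :* Ly) :* E₃)
                   := (((A :* B) :* Lz) :* ((A′ :* B′) :* Ly)) :* ((E₁ :* E₂) :* E₃)) refl A A′ E₁ B B′ E₂ Lz Ly E₃ ⟩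
    (((A ⊗ B) ⊗ Lz) ⊗ ((A′ ⊗ B′) ⊗ Ly)) ⊗ ((E₁ ⊗ E₂) ⊗ E₃)
      ≡⟨ cong₂ _⊗_ (cong₂ _⊗_ (phase≡ c v z) (phase≡ c v y)) (P.trans (ε-+ _ _) (cong (_⊗ E₃) (ε-+ _ _))) ⟨
    (phase c v z ⊗ phase c v y) ⊗ ε (polar c z y) ∎
    where
    open P.≡-Reasoning
    open RingPowers ℚi-commutativeRing using (solve; _:*_; _:=_)
    open P using (refl)
    c = (α , β)
    m = 𝔽.offDiag α β
    A = χ (α F.* (z₁ F.* z₁))
    A′ = χ (α F.* (y₁ F.* y₁))
    E₁ = ε (α F.* (z₁ F.* y₁))
    B = χ (β F.* (z₂ F.* z₂))
    B′ = χ (β F.* (y₂ F.* y₂))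
    E₂ = ε (β F.* (z₂ F.* y₂))
    e₃ = m F.* (z₁ F.* y₂ F.+ y₁ F.* z₂)
    Lz = ε (crossTerm α β v z)
    Ly = ε (crossTerm α β v y)
    E₃ = ε e₃
    cross≈ : crossTerm α β v (z +V y) F.≈ (crossTerm α β v z F.+ crossTerm α β v y) F.+ e₃
    cross≈ = F.solve 7 (λ m v₁ v₂ z₁ z₂ y₁ y₂ →
      m F.:* ((z₁ F.:+ y₁) F.:* (z₂ F.:+ y₂)) F.:+ (v₁ F.:* (z₁ F.:+ y₁) F.:+ v₂ F.:* (z₂ F.:+ y₂))
      F.:= (m F.:* (z₁ F.:* z₂) F.:+ (v₁ F.:* z₁ F.:+ v₂ F.:* z₂) F.:+ (m F.:* (y₁ F.:* y₂) F.:+ (v₁ F.:* y₁ F.:+ v₂ F.:* y₂)))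
           F.:+ m F.:* (z₁ F.:* y₂ F.:+ y₁ F.:* z₂)) F.refl m v₁ v₂ z₁ z₂ y₁ y₂

  conj-phase⊗phase≡1 : ∀ c v w → conj (phase c v w) ⊗ phase c v w ≡ 1i
  conj-phase⊗phase≡1 (α , β) (v₁ , v₂) (w₁ , w₂) = conj-ψ⊗ψ≡1 _

  -- Inner products of the B_c: Gauss sums

  crossPhase : V → V → V → V → V → ℚi
  crossPhase c v c′ v′ w = conj (phase c v w) ⊗ phase c′ v′ w

  crossPhase-resp : ∀ c v c′ v′ → Respects≈V (crossPhase c v c′ v′)
  crossPhase-resp c v c′ v′ w≈w′ = cong₂ (λ a b → conj a ⊗ b) (phase-resp c v w≈w′) (phase-resp c′ v′ w≈w′)

  conj-crossPhase⊗crossPhase≡1 : ∀ c v c′ v′ w → conj (crossPhase c v c′ v′ w) ⊗ crossPhase c v c′ v′ w ≡ 1i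
  conj-crossPhase⊗crossPhase≡1 c v c′ v′ w = begin
    conj (conj X ⊗ Y) ⊗ (conj X ⊗ Y) ≡⟨ cong (_⊗ (conj X ⊗ Y)) (P.trans (conj-⊗ (conj X) Y) (cong (_⊗ conj Y) (conj-involutive X))) ⟩
    (X ⊗ conj Y) ⊗ (conj X ⊗ Y)      ≡⟨ solve 4 (λ x cy cx y → (x :* cy) :* (cx :* y) := (cx :* x) :* (cy :* y)) refl X (conj Y) (conj X) Y ⟩
    (conj X ⊗ X) ⊗ (conj Y ⊗ Y)      ≡⟨ cong₂ _⊗_ (conj-phase⊗phase≡1 c v w) (conj-phase⊗phase≡1 c′ v′ w) ⟩
    1i ⊗ 1i                          ≡⟨⟩
    1i                               ∎
    where
    open P.≡-Reasoning
    open RingPowers ℚi-commutativeRing using (solve; _:*_; _:=_)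
    open P using (refl)
    X = phase c v w
    Y = phase c′ v′ w

  crossPhase-0 : ∀ c v c′ v′ → crossPhase c v c′ v′ 0V ≡ 1i
  crossPhase-0 c v c′ v′ = cong₂ (λ a b → conj a ⊗ b) (phase-0 c v) (phase-0 c′ v′)

  crossPhase-+ : ∀ c v c′ v′ z y → crossPhase c v c′ v′ (z +V y) ≡
                 (crossPhase c v c′ v′ z ⊗ crossPhase c v c′ v′ y) ⊗ ε (polar c z y F.+ polar c′ z y)
  crossPhase-+ c v c′ v′ z y = begin
    conj (phase c v (z +V y)) ⊗ phase c′ v′ (z +V y)
      ≡⟨ cong₂ (λ a b → conj a ⊗ b) (phase-+ c v z y) (phase-+ c′ v′ z y) ⟩
    conj ((Gz ⊗ Gy) ⊗ E) ⊗ ((G′z ⊗ G′y) ⊗ E′)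
      ≡⟨ cong (_⊗ ((G′z ⊗ G′y) ⊗ E′)) (P.trans (conj-⊗ (Gz ⊗ Gy) E) (cong₂ _⊗_ (conj-⊗ Gz Gy) (conj-ε _))) ⟩
    ((conj Gz ⊗ conj Gy) ⊗ E) ⊗ ((G′z ⊗ G′y) ⊗ E′)
      ≡⟨ solve 6 (λ a b e a′ b′ e′ → ((a :* b) :* e) :* ((a′ :* b′) :* e′) := ((a :* a′) :* (b :* b′)) :* (e :* e′))
                 refl (conj Gz) (conj Gy) E G′z G′y E′ ⟩
    ((conj Gz ⊗ G′z) ⊗ (conj Gy ⊗ G′y)) ⊗ (E ⊗ E′)
      ≡⟨ cong (((conj Gz ⊗ G′z) ⊗ (conj Gy ⊗ G′y)) ⊗_) (ε-+ _ _) ⟨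
    (crossPhase c v c′ v′ z ⊗ crossPhase c v c′ v′ y) ⊗ ε (polar c z y F.+ polar c′ z y) ∎
    where
    open P.≡-Reasoning
    open RingPowers ℚi-commutativeRing using (solve; _:*_; _:=_)
    open P using (refl)
    Gz = phase c v z
    Gy = phase c v y
    G′z = phase c′ v′ z
    G′y = phase c′ v′ y
    E = ε (polar c z y)
    E′ = ε (polar c′ z y)

  translate : V → V → V
  translate z y = z +V y

  translate-cong : ∀ z {v w} → v ≈V w → translate z v ≈V translate z w
  translate-cong z (e₁ , e₂) = F.+-congˡ e₁ , F.+-congˡ e₂

  translate-involutive : ∀ z v → translate z (translate z v) ≈V v
  translate-involutive (z₁ , z₂) (v₁ , v₂) = z+[z+v]≈v z₁ v₁ , z+[z+v]≈v z₂ v₂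
    where
    z+[z+v]≈v : ∀ z v → z F.+ (z F.+ v) F.≈ v
    z+[z+v]≈v z v = F.trans (F.sym (F.+-assoc z z v)) (F.trans (F.+-congʳ (𝔽.x+x≈0 z)) (F.+-identityˡ v))

  -- For c ≠ c′ the Gauss sum S = Σ_w conj(phase c v w) phase c′ v′ w has |S|² = q²: substituting w = z + y,
  -- |S|² = Σ_y crossPhase y · Σ_z ε (z M yᵀ) with M = M_c + M_c′ nonsingular, so only y = 0 survives.
  module CrossGaussSum (α β α′ β′ : F.Carrier) (v v′ : V) (c≉c′ : ¬ (α F.≈ α′ × β F.≈ β′)) where

    c = (α , β)
    c′ = (α′ , β′)
    f = crossPhase c v c′ v′
    A = α F.+ α′
    B = β F.+ β′
    S = 𝔽.offDiag α β F.+ 𝔽.offDiag α′ β′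

    l₁ l₂ : V → F.Carrier
    l₁ = linear A S
    l₂ = linear S B

    My≈0⇒y≈0 : ∀ y → ¬ (y ≈V 0V) → ¬ (l₁ y F.≈ F.0# × l₂ y F.≈ F.0#)
    My≈0⇒y≈0 (y₁ , y₂) y≉0 (e₁ , e₂) = y≉0 (𝔽.symmetric-kernel-trivial A B S y₁ y₂ (𝔽.det≉0 α β α′ β′ c≉c′) e₁ e₂)

    polar-sum : ∀ z y → polar c z y F.+ polar c′ z y F.≈ linear (l₁ y) (l₂ y) z
    polar-sum (z₁ , z₂) (y₁ , y₂) = F.solve 10 (λ α β α′ β′ m m′ z₁ z₂ y₁ y₂ →
      (α :* (z₁ :* y₁) :+ β :* (z₂ :* y₂) :+ m :* (z₁ :* y₂ :+ y₁ :* z₂)) :+ (α′ :* (z₁ :* y₁) :+ β′ :* (z₂ :* y₂) :+ m′ :* (z₁ :* y₂ :+ y₁ :* z₂))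
      := ((α :+ α′) :* y₁ :+ (m :+ m′) :* y₂) :* z₁ :+ ((m :+ m′) :* y₁ :+ (β :+ β′) :* y₂) :* z₂)
      F.refl α β α′ β′ (𝔽.offDiag α β) (𝔽.offDiag α′ β′) z₁ z₂ y₁ y₂
      where open F using (_:*_; _:+_; _:=_)

    linear-at-0 : ∀ a b {y} → y ≈V 0V → linear a b y F.≈ F.0#
    linear-at-0 a b y≈0 = F.trans (linear-cong a b y≈0)
      (F.trans (F.+-cong (F.zeroʳ a) (F.zeroʳ b)) (F.+-identityʳ F.0#))

    Σf : ℚi
    Σf = sum {N} (λ i → f (pt i))

    term : Fin N → Fin N → ℚi
    term zi yi = f (pt yi) ⊗ ε (linear (l₁ (pt yi)) (l₂ (pt yi)) (pt zi))

    conj-fz⊗Σf : ∀ zi → conj (f (pt zi)) ⊗ Σf ≡ sum {N} (λ yi → term zi yi)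
    conj-fz⊗Σf zi = begin
      conj fz ⊗ Σf                               ≡⟨ cong (conj fz ⊗_) (sum-reindex (translate z) (translate z)
                                                      (translate-cong z) (translate-cong z) (translate-involutive z)
                                                      (translate-involutive z) f (crossPhase-resp c v c′ v′)) ⟩
      conj fz ⊗ sum {N} (λ yi → f (z +V pt yi))  ≡⟨ *-distribˡ-sum (conj fz) (λ yi → f (z +V pt yi)) ⟩
      sum {N} (λ yi → conj fz ⊗ f (z +V pt yi))  ≡⟨ sum-cong-≗ {N} termwise ⟩
      sum {N} (λ yi → term zi yi)                ∎
      where
      open P.≡-Reasoning
      z = pt zi
      fz = f z
      termwise : ∀ yi → conj fz ⊗ f (z +V pt yi) ≡ term zi yi
      termwise yi = begin
        conj fz ⊗ f (z +V y)                     ≡⟨ cong (conj fz ⊗_) (crossPhase-+ c v c′ v′ z y) ⟩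
        conj fz ⊗ ((fz ⊗ f y) ⊗ E)               ≡⟨ solve 4 (λ a b c d → a :* ((b :* c) :* d) := (a :* b) :* (c :* d)) refl (conj fz) fz (f y) E ⟩
        (conj fz ⊗ fz) ⊗ (f y ⊗ E)               ≡⟨ cong₂ _⊗_ (conj-crossPhase⊗crossPhase≡1 c v c′ v′ z) (cong (f y ⊗_) (ε-cong (polar-sum z y))) ⟩
        1i ⊗ term zi yi                          ≡⟨ ⊗-identityˡ (term zi yi) ⟩
        term zi yi                               ∎
        where
        open RingPowers ℚi-commutativeRing using (solve; _:*_; _:=_)
        open P using (refl)
        y = pt yi
        E = ε (polar c z y F.+ polar c′ z y)

    0ᵢ : Fin N
    0ᵢ = indexV 0V

    Σterm : Fin N → ℚi
    Σterm yi = f (pt yi) ⊗ sum {N} (λ zi → ε (linear (l₁ (pt yi)) (l₂ (pt yi)) (pt zi)))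

    Σterm≡0 : ∀ yi → yi ≢ 0ᵢ → Σterm yi ≡ 0i
    Σterm≡0 yi yi≢0ᵢ = P.trans (cong (f (pt yi) ⊗_) (sum-ε-linear≡0 _ _ (My≈0⇒y≈0 (pt yi) pt≉0))) (⊗-zeroʳ (f (pt yi)))
      where
      pt≉0 : ¬ (pt yi ≈V 0V)
      pt≉0 pt≈0 = yi≢0ᵢ (pt-injective yi 0ᵢ (≈V-trans pt≈0 (≈V-sym (pt-indexV 0V))))

    conj-Σf⊗Σf≡q² : conj Σf ⊗ Σf ≡ q²
    conj-Σf⊗Σf≡q² = begin
      conj Σf ⊗ Σf                                    ≡⟨ cong (_⊗ Σf) (sum-conj N (λ i → f (pt i))) ⟩
      sum {N} (λ zi → conj (f (pt zi))) ⊗ Σf          ≡⟨ *-distribʳ-sum Σf (λ zi → conj (f (pt zi))) ⟩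
      sum {N} (λ zi → conj (f (pt zi)) ⊗ Σf)          ≡⟨ sum-cong-≗ {N} conj-fz⊗Σf ⟩
      sum {N} (λ zi → sum {N} (λ yi → term zi yi))    ≡⟨ ∑-comm {N} {N} term ⟩
      sum {N} (λ yi → sum {N} (λ zi → term zi yi))    ≡⟨ sum-cong-≗ {N} (λ yi → *-distribˡ-sum {N} (f (pt yi)) _) ⟨
      sum {N} Σterm                                   ≡⟨ sum-supported-at N Σterm 0ᵢ Σterm≡0 ⟩
      Σterm 0ᵢ                                        ≡⟨ cong₂ _⊗_ (P.trans (crossPhase-resp c v c′ v′ (pt-indexV 0V)) (crossPhase-0 c v c′ v′))
                                                                    (sum-ε-zero _ _ (linear-at-0 A S (pt-indexV 0V)) (linear-at-0 S B (pt-indexV 0V))) ⟩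
      1i ⊗ q²                                         ≡⟨ ⊗-identityˡ q² ⟩
      q²                                              ∎
      where open P.≡-Reasoning

  crossPhase-same-c : ∀ c v v′ w → crossPhase c v c v′ w ≡ ε (linear (proj₁ v F.+ proj₁ v′) (proj₂ v F.+ proj₂ v′) w)
  crossPhase-same-c c@(α , β) v@(v₁ , v₂) v′@(v₁′ , v₂′) w@(w₁ , w₂) = begin
    conj (phase c v w) ⊗ phase c v′ w                       ≡⟨ cong (conj (phase c v w) ⊗_) (phase≡ c v′ w) ⟩
    conj (phase c v w) ⊗ (X ⊗ ε (crossTerm α β v′ w))       ≡⟨ cong (λ e → conj (phase c v w) ⊗ (X ⊗ e)) (P.trans (ε-cong cross≈) (ε-+ _ _)) ⟩
    conj (phase c v w) ⊗ (X ⊗ (ε (crossTerm α β v w) ⊗ D))  ≡⟨ cong (conj (phase c v w) ⊗_) (⊗-assoc X _ D) ⟨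
    conj (phase c v w) ⊗ ((X ⊗ ε (crossTerm α β v w)) ⊗ D)  ≡⟨ cong (λ p → conj (phase c v w) ⊗ (p ⊗ D)) (phase≡ c v w) ⟨
    conj (phase c v w) ⊗ (phase c v w ⊗ D)                  ≡⟨ ⊗-assoc (conj (phase c v w)) (phase c v w) D ⟨
    (conj (phase c v w) ⊗ phase c v w) ⊗ D                  ≡⟨ cong (_⊗ D) (conj-phase⊗phase≡1 c v w) ⟩
    1i ⊗ D                                                  ≡⟨ ⊗-identityˡ D ⟩
    D                                                       ∎
    where
    open P.≡-Reasoning
    X = diagonalPhase c w
    d = linear (v₁ F.+ v₁′) (v₂ F.+ v₂′) w
    D = ε d
    cross≈ : crossTerm α β v′ w F.≈ crossTerm α β v w F.+ d
    cross≈ = F.sym (F.trans (F.solve 7 (λ m v₁ v₂ v₁′ v₂′ w₁ w₂ →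
      (m :* (w₁ :* w₂) :+ (v₁ :* w₁ :+ v₂ :* w₂)) :+ ((v₁ :+ v₁′) :* w₁ :+ (v₂ :+ v₂′) :* w₂)
      := (m :* (w₁ :* w₂) :+ (v₁′ :* w₁ :+ v₂′ :* w₂)) :+ (con 1 :+ con 1) :* (v₁ :* w₁ :+ v₂ :* w₂))
      F.refl (𝔽.offDiag α β) v₁ v₂ v₁′ v₂′ w₁ w₂) (𝔽.x+2y≈x _ _))
      where open F using (con; _:*_; _:+_; _:=_)


  q⁻¹ : ℚi
  q⁻¹ = C.invQ +i 0ℚ

  N⁻¹ : ℚ
  N⁻¹ = ((+ 1) ℚ./ N) {{qq-nonZero k}}

  inner-b-b : ∀ ci vi ci′ vi′ → inner (C.b ci vi) (C.b ci′ vi′) ≡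
              (q⁻¹ ⊗ q⁻¹) ⊗ sum {N} (λ w → crossPhase (pt ci) (pt vi) (pt ci′) (pt vi′) (pt w))
  inner-b-b ci vi ci′ vi′ = P.trans (sumi≡sum N _)
    (P.trans (sum-cong-≗ {N} termwise) (P.sym (*-distribˡ-sum {N} (q⁻¹ ⊗ q⁻¹) _)))
    where
    open RingPowers ℚi-commutativeRing using (solve; _:*_; _:=_)
    termwise : ∀ w → conj (C.b ci vi w) ⊗ C.b ci′ vi′ w ≡ (q⁻¹ ⊗ q⁻¹) ⊗ crossPhase (pt ci) (pt vi) (pt ci′) (pt vi′) (pt w)
    termwise w = P.trans (cong (_⊗ (q⁻¹ ⊗ Y)) (conj-⊗ q⁻¹ X))
      (solve 4 (λ a cx a′ y → (a :* cx) :* (a′ :* y) := (a :* a′) :* (cx :* y)) P.refl q⁻¹ (conj X) q⁻¹ Y)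
      where
      X = phase (pt ci) (pt vi) (pt w)
      Y = phase (pt ci′) (pt vi′) (pt w)

  q⁻¹⊗q⁻¹≡N⁻¹ : q⁻¹ ⊗ q⁻¹ ≡ N⁻¹ +i 0ℚ
  q⁻¹⊗q⁻¹≡N⁻¹ = cong₂ _+i_
    (P.trans (solve 1 (λ a → a :* a :- con 0ℚ :* con 0ℚ := a :* a) P.refl C.invQ) (1/n*1/n≡1/n*n q {{qOf-nonZero k}}))
    (solve 1 (λ a → a :* con 0ℚ :+ con 0ℚ :* a := con 0ℚ) P.refl C.invQ)
    where open +-*-Solver

  normSq-q⁻¹⊗q⁻¹ : normSq (q⁻¹ ⊗ q⁻¹) ≡ N⁻¹ ℚ.* N⁻¹
  normSq-q⁻¹⊗q⁻¹ = P.trans (cong normSq q⁻¹⊗q⁻¹≡N⁻¹)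
    (solve 1 (λ a → a :* a :+ con 0ℚ :* con 0ℚ := a :* a) P.refl N⁻¹)
    where open +-*-Solver

  q⁻¹⊗q⁻¹⊗q²≡1 : (q⁻¹ ⊗ q⁻¹) ⊗ q² ≡ 1i
  q⁻¹⊗q⁻¹⊗q²≡1 = P.trans (cong₂ _⊗_ q⁻¹⊗q⁻¹≡N⁻¹ (sum-ones N)) (cong₂ _+i_
    (P.trans (solve 2 (λ a b → a :* b :- con 0ℚ :* con 0ℚ := a :* b) P.refl N⁻¹ (ℕ→ℚ N)) (1/n*n≡1 N {{qq-nonZero k}}))
    (solve 2 (λ a b → a :* con 0ℚ :+ con 0ℚ :* b := con 0ℚ) P.refl N⁻¹ (ℕ→ℚ N)))
    where open +-*-Solver

  normSq-q⁻²S≡N⁻¹ : ∀ S → conj S ⊗ S ≡ q² → normSq ((q⁻¹ ⊗ q⁻¹) ⊗ S) ≡ N⁻¹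
  normSq-q⁻²S≡N⁻¹ S |S|²≡q² = begin
    normSq ((q⁻¹ ⊗ q⁻¹) ⊗ S)                  ≡⟨ normSq-⊗ (q⁻¹ ⊗ q⁻¹) S ⟩
    normSq (q⁻¹ ⊗ q⁻¹) ℚ.* normSq S           ≡⟨ cong₂ ℚ._*_ normSq-q⁻¹⊗q⁻¹ normSq-S ⟩
    (N⁻¹ ℚ.* N⁻¹) ℚ.* ℕ→ℚ N                   ≡⟨ ℚP.*-assoc N⁻¹ N⁻¹ (ℕ→ℚ N) ⟩
    N⁻¹ ℚ.* (N⁻¹ ℚ.* ℕ→ℚ N)                   ≡⟨ cong (N⁻¹ ℚ.*_) (1/n*n≡1 N {{qq-nonZero k}}) ⟩
    N⁻¹ ℚ.* 1ℚ                                ≡⟨ ℚP.*-identityʳ N⁻¹ ⟩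
    N⁻¹                                       ∎
    where
    open P.≡-Reasoning
    normSq-S : normSq S ≡ ℕ→ℚ N
    normSq-S = cong re (P.trans (P.sym (conj⊗self≡normSq S)) (P.trans |S|²≡q² (sum-ones N)))

  normSq-b : ∀ c v w → normSq (C.b c v w) ≡ N⁻¹
  normSq-b c v w = P.trans (normSq-⊗ q⁻¹ (phase (pt c) (pt v) (pt w)))
    (P.trans (cong₂ ℚ._*_ normSq-q⁻¹ (normSq-ψ _)) (ℚP.*-identityʳ N⁻¹))
    where
    normSq-q⁻¹ : normSq q⁻¹ ≡ N⁻¹
    normSq-q⁻¹ = P.trans (solve 1 (λ a → a :* a :+ con 0ℚ :* con 0ℚ := a :* a) P.refl C.invQ) (1/n*1/n≡1/n*n q {{qOf-nonZero k}})
      where open +-*-Solver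

  inner-b-self : ∀ ci vi → inner (C.b ci vi) (C.b ci vi) ≡ 1i
  inner-b-self ci vi = P.trans (inner-b-b ci vi ci vi)
    (P.trans (cong ((q⁻¹ ⊗ q⁻¹) ⊗_) (sum-cong-≗ {N} (λ w → conj-phase⊗phase≡1 (pt ci) (pt vi) (pt w)))) q⁻¹⊗q⁻¹⊗q²≡1)

  inner-b-orthogonal : ∀ ci vi vi′ → vi ≢ vi′ → inner (C.b ci vi) (C.b ci vi′) ≡ 0i
  inner-b-orthogonal ci vi vi′ vi≢vi′ = P.trans (inner-b-b ci vi ci vi′)
    (P.trans (cong ((q⁻¹ ⊗ q⁻¹) ⊗_) (P.trans (sum-cong-≗ {N} (λ w → crossPhase-same-c (pt ci) (pt vi) (pt vi′) (pt w)))
      (sum-ε-linear≡0 _ _ v+v′≉0))) (⊗-zeroʳ (q⁻¹ ⊗ q⁻¹)))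
    where
    v+v′≉0 : ¬ ((proj₁ (pt vi) F.+ proj₁ (pt vi′) F.≈ F.0#) × (proj₂ (pt vi) F.+ proj₂ (pt vi′) F.≈ F.0#))
    v+v′≉0 (e₁ , e₂) = vi≢vi′ (pt-injective vi vi′ (𝔽.x+y≈0⇒x≈y e₁ , 𝔽.x+y≈0⇒x≈y e₂))

  inner-b-unbiased : ∀ ci ci′ → ci ≢ ci′ → ∀ vi vi′ → normSq (inner (C.b ci vi) (C.b ci′ vi′)) ≡ N⁻¹
  inner-b-unbiased ci ci′ ci≢ci′ vi vi′ = P.trans (cong normSq (inner-b-b ci vi ci′ vi′))
    (normSq-q⁻²S≡N⁻¹ _ (CrossGaussSum.conj-Σf⊗Σf≡q² α β α′ β′ (pt vi) (pt vi′)
      (λ (e₁ , e₂) → ci≢ci′ (pt-injective ci ci′ (e₁ , e₂)))))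
    where
    α = proj₁ (pt ci)
    β = proj₂ (pt ci)
    α′ = proj₁ (pt ci′)
    β′ = proj₂ (pt ci′)

  e-diag : ∀ v → C.e v v ≡ 1i
  e-diag v with v Fin.≟ v
  ... | yes _ = P.refl
  ... | no v≢v = ⊥-elim (v≢v P.refl)

  e-offdiag : ∀ v w → v ≢ w → C.e v w ≡ 0i
  e-offdiag v w v≢w with v Fin.≟ w
  ... | yes v≡w = ⊥-elim (v≢w v≡w)
  ... | no _ = P.refl

  inner-e-left : ∀ v (y : Fin N → ℚi) → inner (C.e v) y ≡ y v
  inner-e-left v y = P.trans (sumi≡sum N _) (P.trans
    (sum-supported-at N _ v (λ w w≢v → P.trans (cong (λ z → conj z ⊗ y w) (e-offdiag v w (λ v≡w → w≢v (P.sym v≡w)))) (⊗-zeroˡ (y w))))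
    (P.trans (cong (λ z → conj z ⊗ y v) (e-diag v)) (⊗-identityˡ (y v))))

  inner-e-right : ∀ v (y : Fin N → ℚi) → inner y (C.e v) ≡ conj (y v)
  inner-e-right v y = P.trans (sumi≡sum N _) (P.trans
    (sum-supported-at N _ v (λ w w≢v → P.trans (cong (conj (y w) ⊗_) (e-offdiag v w (λ v≡w → w≢v (P.sym v≡w)))) (⊗-zeroʳ (conj (y w)))))
    (P.trans (cong (conj (y v) ⊗_) (e-diag v)) (⊗-identityʳ (conj (y v)))))

  isCompleteMUB : IsCompleteMUB N {{qq-nonZero k}} C.bases
  isCompleteMUB = orthonormal , unbiased
    where
    orthonormal : ∀ a → IsOrthonormalBasis N (C.bases a)
    orthonormal zero = (λ v → P.trans (inner-e-left v (C.e v)) (e-diag v))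
                     , (λ v v′ v≢v′ → P.trans (inner-e-left v (C.e v′)) (e-offdiag v′ v (λ e → v≢v′ (P.sym e))))
    orthonormal (suc c) = inner-b-self c , inner-b-orthogonal c
    unbiased : ∀ a b → a ≢ b → ∀ x y → normSq (inner (C.bases a x) (C.bases b y)) ≡ N⁻¹
    unbiased zero zero a≢b _ _ = ⊥-elim (a≢b P.refl)
    unbiased zero (suc c) _ v y = P.trans (cong normSq (inner-e-left v (C.b c y))) (normSq-b c y v)
    unbiased (suc c) zero _ y v = P.trans (cong normSq (inner-e-right v (C.b c y))) (P.trans (normSq-conj (C.b c y v)) (normSq-b c y v))
    unbiased (suc c) (suc c′) a≢b y y′ = inner-b-unbiased c c′ (λ e → a≢b (cong suc e)) y y′

open import Defs
open import Level using (0ℓ)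
open import Data.Nat using (ℕ; _*_)
open import Data.Fin using (Fin)
open import Data.Product using (_×_; ∃; proj₁; proj₂)
open import Relation.Binary using (Decidable)
open import Relation.Binary.PropositionalEquality using (_≡_)
open import Algebra.Bundles using (CommutativeRing)
open import Algebra.Morphism.Structures using (module RingMorphisms)

mainTheorem12 :
    (k : ℕ) →
    (F : CommutativeRing 0ℓ 0ℓ) → RingNotions.IsField F →
    (enumF : Fin (qOf k) → CommutativeRing.Carrier F) →
    RingNotions.IsEnumeration F (qOf k) enumF →
    (R : CommutativeRing 0ℓ 0ℓ) →
    (_≈R?_ : Decidable (CommutativeRing._≈_ R)) →
    RingNotions.HasChar4 R →
    (π : CommutativeRing.Carrier R → CommutativeRing.Carrier F) →
    RingMorphisms.IsRingHomomorphism (CommutativeRing.rawRing R) (CommutativeRing.rawRing F) π →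
    (∀ u → ∃ λ x → CommutativeRing._≈_ F (π x) u) →
    (∀ x → (CommutativeRing._≈_ F (π x) (CommutativeRing.0# F) →
              ∃ λ y → CommutativeRing._≈_ R x (CommutativeRing._*_ R (RingNotions.two R) y))
         × ((∃ λ y → CommutativeRing._≈_ R x (CommutativeRing._*_ R (RingNotions.two R) y)) →
              CommutativeRing._≈_ F (π x) (CommutativeRing.0# F))) →
    (hat : CommutativeRing.Carrier F → CommutativeRing.Carrier R) →
    (∀ u → RingNotions.InTeich R (qOf k) (hat u) × CommutativeRing._≈_ F (π (hat u)) u) →
    (decomp : CommutativeRing.Carrier R →
              CommutativeRing.Carrier R × CommutativeRing.Carrier R) →
    (∀ x → RingNotions.InTeich R (qOf k) (proj₁ (decomp x))
         × RingNotions.InTeich R (qOf k) (proj₂ (decomp x))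
         × CommutativeRing._≈_ R x
             (CommutativeRing._+_ R (proj₁ (decomp x))
               (CommutativeRing._*_ R (RingNotions.two R) (proj₂ (decomp x))))) →
    (ω : ℚi) → ω ⊗ ω ≡ -1i →
    IsCompleteMUB (qOf k * qOf k) {{qq-nonZero k}}
      (Construction.bases k F enumF R _≈R?_ hat decomp ω)
mainTheorem12 k F isField enumF isEnum R _≈R?_ hasChar4 π isHom _ kerπ hat isLift decomp isDecomp ω ω²≡-1 =
  MutuallyUnbiasedBases.isCompleteMUB k F isField enumF isEnum R _≈R?_ hasChar4 π isHom kerπ hat isLift decomp isDecomp ω ω²≡-1
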